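{- Let $n\ge 1$ and let $a,b$ be positive integers with $a+b\le 2^n$. Let $g_1,g_2\in \mathrm{Aut}(Q_n)$. Then $$m(g_1(I_a))+m(g_2(I_b))=m(I_{a+b})$$ (equality of vectors in $\mathbb{Z}^n$) if and only if $g_1(I_a)\cup g_2(I_b)=I_{a+b}$.
   Context: $Q_n=\{0,1\}^n$ is the hypercube graph: vertices are binary strings $x=x_0x_1\ldots x_{n-1}$, and two strings are adjacent iff they differ in exactly one digit. $\mathrm{Aut}(Q_n)$ is its graph automorphism group. Each $x\in Q_n$ is identified with the integer $\sum_{i=0}^{n-1}x_i2^{n-1-i}$ (binary order, $x_0$ most significant). For $0\le k\le 2^n$, the initial segment $I_k\subseteq Q_n$ is the set of $x\in Q_n$ whose integer value is $<k$. For $S\subseteq Q_n$ and $0\le i\le n-1$, $m_i(S)$ is the number of $x\in S$ with $x_i=1$, and $m(S)=(m_0(S),\ldots,m_{n-1}(S))$. -}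

module Defs where

open import Data.Nat using (ℕ; zero; suc; _+_; _*_; _^_; _<_; _<ᵇ_)
open import Data.Bool using (Bool; true; false; _∨_; _∧_; if_then_else_)
open import Data.Vec using (Vec; []; _∷_; lookup)
open import Data.Fin using (Fin)
open import Data.List using (List; []; _∷_; map; _++_; length; filter)
open import Data.Product using (_×_)
open import Function.Bundles using (Inverse)
open import Relation.Binary.PropositionalEquality using (_≡_; setoid)
open import Relation.Nullary using (Dec; yes; no)

Q : ℕ → Set
Q n = Vec Bool n

hamming : ∀ {n} → Q n → Q n → ℕ
hamming [] [] = 0
hamming (true ∷ xs) (false ∷ ys) = suc (hamming xs ys)
hamming (false ∷ xs) (true ∷ ys) = suc (hamming xs ys)
hamming (_ ∷ xs) (_ ∷ ys) = hamming xs ys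

Adj : ∀ {n} → Q n → Q n → Set
Adj x y = hamming x y ≡ 1

record Aut (n : ℕ) : Set where
  field
    perm     : Inverse (setoid (Q n)) (setoid (Q n))
  open Inverse perm public using (to; from)
  field
    preserves : ∀ x y → (Adj x y → Adj (to x) (to y)) × (Adj (to x) (to y) → Adj x y)

-- integer value with x₀ most significant
val : ∀ {n} → Q n → ℕ
val {zero} [] = 0
val {suc n} (b ∷ xs) = (if b then 2 ^ n else 0) + val xs

Subset : ℕ → Set
Subset n = Q n → Bool

I : ∀ {n} → ℕ → Subset n
I k x = val x <ᵇ k

image : ∀ {n} → Aut n → Subset n → Subset n
image g S y = S (Aut.from g y)

_∪_ : ∀ {n} → Subset n → Subset n → Subset n
(S ∪ T) x = S x ∨ T x

_≐_ : ∀ {n} → Subset n → Subset n → Set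
S ≐ T = ∀ x → S x ≡ T x

allQ : (n : ℕ) → List (Q n)
allQ zero = [] ∷ []
allQ (suc n) = map (false ∷_) (allQ n) ++ map (true ∷_) (allQ n)

countIn : ∀ {n} → Subset n → (Q n → Bool) → ℕ
countIn {n} S p = count (allQ n)
  where
  count : List (Q n) → ℕ
  count [] = 0
  count (x ∷ xs) = (if S x ∧ p x then 1 else 0) + count xs

m : ∀ {n} → Subset n → Fin n → ℕ
m S i = countIn S (λ x → lookup x i)

MSumEq : ∀ {n} → Subset n → Subset n → Subset n → Set
MSumEq S T U = ∀ i → m S i + m T i ≡ m U i

-- Every automorphism of Q n is a coordinate permutation followed by a translation. So X = g₁(I a),
-- Y = g₂(I b) and W = ∁ I (a + b) are all images of initial segments under such maps, with sizes
-- adding up to 2^n, and m(X) + m(Y) = m(I (a + b)) says that together they put exactly 2^(n-1)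
-- points on each side of every coordinate. Such a balanced triple must partition the cube; the
-- converse direction is just counting. The partition is proved by induction on n. If one set has at
-- least 2^(n-1) points it fills a half cube, balance keeps the other two out of it, and the
-- induction hypothesis applies to the other half. Otherwise each set lies in a half cube. If two of
-- them lie in half cubes orthogonal to the same coordinate, balance forces them to be disjoint, and
-- then their union has the size and the column sums of the complement of the third, which pins it
-- down. If the three coordinates are distinct, every set is badly unbalanced along the other two
-- coordinates, and the resulting inequalities add up to 3 · 2^n < 3 · 2^n.

module Submission where

open import Defs
open import Data.Bool using (Bool; true; false; _∨_; _∧_; not; _xor_; if_then_else_)
open import Data.Bool.Properties using (∧-comm; ∧-zeroʳ; ∧-identityʳ; not-involutive)
import Data.Bool.Properties as Bool
open import Data.Empty using (⊥; ⊥-elim)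
open import Data.Fin using (Fin; zero; suc)
import Data.Fin.Properties as Fin
open import Data.Fin.Permutation as Perm
  using (Permutation′; _⟨$⟩ʳ_; _⟨$⟩ˡ_; inverseˡ; inverseʳ; _∘ₚ_; remove; lift₀-remove)
import Data.Fin.Permutation.Components as PC
open import Data.List using (List; []; _∷_; map; _++_)
open import Data.List.Properties using (map-++; map-∘)
open import Data.Nat using (ℕ; zero; suc; _+_; _*_; _^_; _≤_; _<_; _∸_; z≤n; s≤s; _<ᵇ_; _≤?_; _<?_; ∣_-_∣)
open import Data.Nat.Properties hiding (_≟_)
open import Data.Nat.Induction using (<-rec)
open import Data.Nat.ListAction using (sum)
open import Data.Nat.ListAction.Properties using (sum-++)
open import Data.Nat.Solver using (module +-*-Solver)
open +-*-Solver using (solve; _:+_; _:*_; _:=_; con)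
open import Algebra.Properties.CommutativeSemigroup +-commutativeSemigroup
  using (interchange; x∙yz≈y∙xz; xy∙z≈xz∙y; xy∙z≈zx∙y)
open import Data.Product using (_×_; _,_; proj₁; proj₂; Σ)
open import Data.Sum using (_⊎_; inj₁; inj₂; map₁)
open import Data.Vec using ([]; _∷_; lookup; tabulate; replicate; tail)
open import Data.Vec.Properties using (lookup∘tabulate; lookup-replicate)
import Data.Vec.Properties as Vec
open import Data.Vec.Relation.Binary.Pointwise.Extensional using (ext; Pointwise-≡⇒≡)
open import Function using (_∘_)
open import Function.Bundles using (_⇔_; mk⇔; Inverse; Equivalence)
open import Relation.Binary.PropositionalEquality
open import Relation.Nullary using (Dec; yes; no; does)

-- Sums over the cube

ind : Bool → ℕ
ind b = if b then 1 else 0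

∑ : ∀ n → (Q n → ℕ) → ℕ
∑ zero    f = f []
∑ (suc n) f = ∑ n (f ∘ (false ∷_)) + ∑ n (f ∘ (true ∷_))

∑-cong : ∀ n {f g : Q n → ℕ} → f ≗ g → ∑ n f ≡ ∑ n g
∑-cong zero    f≗g = f≗g []
∑-cong (suc n) f≗g = cong₂ _+_ (∑-cong n (f≗g ∘ (false ∷_))) (∑-cong n (f≗g ∘ (true ∷_)))

∑-distrib-+ : ∀ n (f g : Q n → ℕ) → ∑ n (λ x → f x + g x) ≡ ∑ n f + ∑ n g
∑-distrib-+ zero    f g = refl
∑-distrib-+ (suc n) f g = trans (cong₂ _+_ (∑-distrib-+ n _ _) (∑-distrib-+ n _ _))
  (interchange (∑ n (f ∘ (false ∷_))) (∑ n (g ∘ (false ∷_))) (∑ n (f ∘ (true ∷_))) (∑ n (g ∘ (true ∷_))))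

∑-const : ∀ n k → ∑ n (λ _ → k) ≡ k * 2 ^ n
∑-const zero    k = sym (*-identityʳ k)
∑-const (suc n) k = begin
  ∑ n (λ _ → k) + ∑ n (λ _ → k) ≡⟨ cong₂ _+_ (∑-const n k) (∑-const n k) ⟩
  k * 2 ^ n + k * 2 ^ n         ≡⟨ sym (*-distribˡ-+ k (2 ^ n) (2 ^ n)) ⟩
  k * (2 ^ n + 2 ^ n)           ≡⟨ cong (λ t → k * (2 ^ n + t)) (sym (+-identityʳ (2 ^ n))) ⟩
  k * 2 ^ suc n                 ∎
  where open ≡-Reasoning

∑-zero : ∀ n → ∑ n (λ _ → 0) ≡ 0
∑-zero n = ∑-const n 0

∑-mono-≤ : ∀ n {f g : Q n → ℕ} → (∀ x → f x ≤ g x) → ∑ n f ≤ ∑ n g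
∑-mono-≤ zero    f≤g = f≤g []
∑-mono-≤ (suc n) f≤g = +-mono-≤ (∑-mono-≤ n (f≤g ∘ (false ∷_))) (∑-mono-≤ n (f≤g ∘ (true ∷_)))

+-mono-≤-≡⇒≡ˡ : ∀ {a b c d} → a ≤ c → b ≤ d → a + b ≡ c + d → a ≡ c
+-mono-≤-≡⇒≡ˡ {a} {b} {c} a≤c b≤d eq =
  ≤-antisym a≤c (+-cancelʳ-≤ b c a (≤-trans (+-monoʳ-≤ c b≤d) (≤-reflexive (sym eq))))

+-mono-≤-≡⇒≡ʳ : ∀ {a b c d} → a ≤ c → b ≤ d → a + b ≡ c + d → b ≡ d
+-mono-≤-≡⇒≡ʳ {a} {b} {c} {d} a≤c b≤d eq =
  +-mono-≤-≡⇒≡ˡ b≤d a≤c (trans (+-comm b a) (trans eq (+-comm c d)))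

∑-mono-≤-≡⇒≗ : ∀ n {f g : Q n → ℕ} → (∀ x → f x ≤ g x) → ∑ n f ≡ ∑ n g → f ≗ g
∑-mono-≤-≡⇒≗ zero    f≤g eq [] = eq
∑-mono-≤-≡⇒≗ (suc n) f≤g eq (false ∷ x) = ∑-mono-≤-≡⇒≗ n (f≤g ∘ (false ∷_))
  (+-mono-≤-≡⇒≡ˡ (∑-mono-≤ n (f≤g ∘ (false ∷_))) (∑-mono-≤ n (f≤g ∘ (true ∷_))) eq) x
∑-mono-≤-≡⇒≗ (suc n) f≤g eq (true ∷ x) = ∑-mono-≤-≡⇒≗ n (f≤g ∘ (true ∷_))
  (+-mono-≤-≡⇒≡ʳ (∑-mono-≤ n (f≤g ∘ (false ∷_))) (∑-mono-≤ n (f≤g ∘ (true ∷_))) eq) x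

∑≡0⇒≗0 : ∀ n {f : Q n → ℕ} → ∑ n f ≡ 0 → ∀ x → f x ≡ 0
∑≡0⇒≗0 n eq x = sym (∑-mono-≤-≡⇒≗ n (λ _ → z≤n) (trans (∑-zero n) (sym eq)) x)

∑-comm : ∀ n k (F : Q n → Q k → ℕ) → ∑ n (λ x → ∑ k (F x)) ≡ ∑ k (λ y → ∑ n (λ x → F x y))
∑-comm zero    k F = refl
∑-comm (suc n) k F = trans (cong₂ _+_ (∑-comm n k _) (∑-comm n k _)) (sym (∑-distrib-+ k _ _))

_≟_ : ∀ {n} (x y : Q n) → Dec (x ≡ y)
_≟_ = Vec.≡-dec Bool._≟_

δ : ∀ {n} → Q n → Q n → ℕ
δ x y = ind (does (x ≟ y))

∑-δ : ∀ n (z : Q n) (g : Q n → ℕ) → ∑ n (λ x → δ x z * g x) ≡ g z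
∑-δ zero    []          g = +-identityʳ (g [])
∑-δ (suc n) (false ∷ z) g = trans (cong₂ _+_ (∑-δ n z (g ∘ (false ∷_))) (∑-zero n)) (+-identityʳ _)
∑-δ (suc n) (true ∷ z)  g = cong₂ _+_ (∑-zero n) (∑-δ n z (g ∘ (true ∷_)))

δ-inverse : ∀ {n} {φ ψ : Q n → Q n} → (∀ x → ψ (φ x) ≡ x) → (∀ y → φ (ψ y) ≡ y) →
              ∀ x y → δ y (φ x) ≡ δ x (ψ y)
δ-inverse {φ = φ} {ψ} ψφ φψ x y with y ≟ φ x | x ≟ ψ y
... | yes _    | yes _    = refl
... | no  _    | no  _    = refl
... | yes refl | no  x≢ψy = ⊥-elim (x≢ψy (sym (ψφ x)))
... | no  y≢φx | yes refl = ⊥-elim (y≢φx (sym (φψ y)))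

∑-reindex : ∀ n (φ ψ : Q n → Q n) → (∀ x → ψ (φ x) ≡ x) → (∀ y → φ (ψ y) ≡ y) →
            (f : Q n → ℕ) → ∑ n (f ∘ φ) ≡ ∑ n f
∑-reindex n φ ψ ψφ φψ f = begin
  ∑ n (f ∘ φ)                                 ≡⟨ ∑-cong n (λ x → sym (∑-δ n (φ x) f)) ⟩
  ∑ n (λ x → ∑ n (λ y → δ y (φ x) * f y))    ≡⟨ ∑-comm n n (λ x y → δ y (φ x) * f y) ⟩
  ∑ n (λ y → ∑ n (λ x → δ y (φ x) * f y))
    ≡⟨ ∑-cong n (λ y → ∑-cong n (λ x → cong (_* f y) (δ-inverse {φ = φ} {ψ} ψφ φψ x y))) ⟩
  ∑ n (λ y → ∑ n (λ x → δ x (ψ y) * f y))    ≡⟨ ∑-cong n (λ y → ∑-δ n (ψ y) (λ _ → f y)) ⟩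
  ∑ n f                                       ∎
  where open ≡-Reasoning

sum-map-allQ : ∀ n (g : Q n → ℕ) → sum (map g (allQ n)) ≡ ∑ n g
sum-map-allQ zero    g = +-identityʳ (g [])
sum-map-allQ (suc n) g = begin
  sum (map g (map (false ∷_) (allQ n) ++ map (true ∷_) (allQ n)))
    ≡⟨ cong sum (map-++ g (map (false ∷_) (allQ n)) _) ⟩
  sum (map g (map (false ∷_) (allQ n)) ++ map g (map (true ∷_) (allQ n)))
    ≡⟨ sum-++ (map g (map (false ∷_) (allQ n))) _ ⟩
  sum (map g (map (false ∷_) (allQ n))) + sum (map g (map (true ∷_) (allQ n)))
    ≡⟨ sym (cong₂ _+_ (cong sum (map-∘ (allQ n))) (cong sum (map-∘ (allQ n)))) ⟩
  sum (map (g ∘ (false ∷_)) (allQ n)) + sum (map (g ∘ (true ∷_)) (allQ n))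
    ≡⟨ cong₂ _+_ (sum-map-allQ n _) (sum-map-allQ n _) ⟩
  ∑ (suc n) g ∎
  where open ≡-Reasoning

sum-map-unique : ∀ {A : Set} (g : A → ℕ) (f : List A → ℕ) → f [] ≡ 0 →
                 (∀ x xs → f (x ∷ xs) ≡ g x + f xs) → ∀ xs → f xs ≡ sum (map g xs)
sum-map-unique g f f[] f∷ []       = f[]
sum-map-unique g f f[] f∷ (x ∷ xs) = trans (f∷ x xs) (cong (g x +_) (sum-map-unique g f f[] f∷ xs))

-- countIn folds a local function over allQ n; abstracting allQ n exposes it to sum-map-unique.
countIn≡∑ : ∀ {n} (S p : Subset n) → countIn S p ≡ ∑ n (λ x → ind (S x ∧ p x))
countIn≡∑ {n} S p with sum-map-unique (λ x → ind (S x ∧ p x)) _ refl (λ _ _ → refl)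
... | count≡sum with allQ n | sum-map-allQ n (λ x → ind (S x ∧ p x))
... | xs | sum≡∑ = trans (count≡sum xs) sum≡∑

-- Sizes and column sums of subsets

∣_∣ : ∀ {n} → Subset n → ℕ
∣_∣ {n} S = ∑ n (ind ∘ S)

M : ∀ {n} → Subset n → Fin n → ℕ
M {n} S i = ∑ n (λ x → ind (S x ∧ lookup x i))

m≡M : ∀ {n} (S : Subset n) i → m S i ≡ M S i
m≡M S i = countIn≡∑ S (λ x → lookup x i)

full : ∀ {n} → Subset n
full _ = true

∁ : ∀ {n} → Subset n → Subset n
∁ S = not ∘ S

Disjoint : ∀ {n} → Subset n → Subset n → Set
Disjoint S T = ∀ x → S x ∧ T x ≡ false

∣∣-cong : ∀ {n} {S T : Subset n} → S ≐ T → ∣ S ∣ ≡ ∣ T ∣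
∣∣-cong {n} S≐T = ∑-cong n (cong ind ∘ S≐T)

M-cong : ∀ {n} {S T : Subset n} → S ≐ T → ∀ i → M S i ≡ M T i
M-cong {n} S≐T i = ∑-cong n (λ x → cong (λ b → ind (b ∧ lookup x i)) (S≐T x))

ind≡0⇒false : ∀ {b} → ind b ≡ 0 → b ≡ false
ind≡0⇒false {false} _ = refl

ind≡1⇒true : ∀ {b} → ind b ≡ 1 → b ≡ true
ind≡1⇒true {true} _ = refl

ind≤1 : ∀ b → ind b ≤ 1
ind≤1 false = z≤n
ind≤1 true  = ≤-refl

ind-∧-≤ : ∀ a b → ind (a ∧ b) ≤ ind a
ind-∧-≤ false b = z≤n
ind-∧-≤ true  b = ind≤1 b

M≤∣∣ : ∀ {n} (S : Subset n) i → M S i ≤ ∣ S ∣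
M≤∣∣ {n} S i = ∑-mono-≤ n (λ x → ind-∧-≤ (S x) (lookup x i))

M≡0⇒⊆face : ∀ {n} (S : Subset n) i → M S i ≡ 0 → ∀ x → S x ≡ true → lookup x i ≡ false
M≡0⇒⊆face {n} S i M≡0 x Sx =
  ind≡0⇒false (trans (cong (λ b → ind (b ∧ lookup x i)) (sym Sx)) (∑≡0⇒≗0 n M≡0 x))

M≡∣∣⇒⊆face : ∀ {n} (S : Subset n) i → M S i ≡ ∣ S ∣ → ∀ x → S x ≡ true → lookup x i ≡ true
M≡∣∣⇒⊆face {n} S i M≡∣S∣ x Sx = ind≡1⇒true (begin
  ind (lookup x i)            ≡⟨ cong (λ b → ind (b ∧ lookup x i)) (sym Sx) ⟩
  ind (S x ∧ lookup x i)      ≡⟨ ∑-mono-≤-≡⇒≗ n (λ y → ind-∧-≤ (S y) (lookup y i)) M≡∣S∣ x ⟩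
  ind (S x)                   ≡⟨ cong ind Sx ⟩
  1                           ∎)
  where open ≡-Reasoning

∣∣≡0⇒empty : ∀ {n} (S : Subset n) → ∣ S ∣ ≡ 0 → ∀ x → S x ≡ false
∣∣≡0⇒empty {n} S ∣S∣≡0 x = ind≡0⇒false (∑≡0⇒≗0 n ∣S∣≡0 x)

∣∣≡2^n⇒full : ∀ {n} (S : Subset n) → ∣ S ∣ ≡ 2 ^ n → S ≐ full
∣∣≡2^n⇒full {n} S ∣S∣≡2^n x = ind≡1⇒true
  (∑-mono-≤-≡⇒≗ n (ind≤1 ∘ S) (trans ∣S∣≡2^n (sym (trans (∑-const n 1) (*-identityˡ _)))) x)

ind-∨ : ∀ a b → a ∧ b ≡ false → ind (a ∨ b) ≡ ind a + ind b
ind-∨ false b _ = refl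
ind-∨ true false _ = refl

ind-∨-∧ : ∀ a b c → a ∧ b ≡ false → ind ((a ∨ b) ∧ c) ≡ ind (a ∧ c) + ind (b ∧ c)
ind-∨-∧ false b     c _ = refl
ind-∨-∧ true  false c _ = sym (+-identityʳ _)

∣∪∣ : ∀ {n} {S T : Subset n} → Disjoint S T → ∣ S ∪ T ∣ ≡ ∣ S ∣ + ∣ T ∣
∣∪∣ {n} {S} {T} S∩T≡∅ = trans (∑-cong n (λ x → ind-∨ (S x) (T x) (S∩T≡∅ x))) (∑-distrib-+ n _ _)

M-∪ : ∀ {n} {S T : Subset n} → Disjoint S T → ∀ i → M (S ∪ T) i ≡ M S i + M T i
M-∪ {n} {S} {T} S∩T≡∅ i =
  trans (∑-cong n (λ x → ind-∨-∧ (S x) (T x) (lookup x i) (S∩T≡∅ x))) (∑-distrib-+ n _ _)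

∣∪∣≡+⇒Disjoint : ∀ {n} {S T : Subset n} → ∣ S ∪ T ∣ ≡ ∣ S ∣ + ∣ T ∣ → Disjoint S T
∣∪∣≡+⇒Disjoint {n} {S} {T} eq x = ind≡0⇒false (∑≡0⇒≗0 n ∣S∩T∣≡0 x)
  where
  inclusion–exclusion : ∀ a b → ind (a ∨ b) + ind (a ∧ b) ≡ ind a + ind b
  inclusion–exclusion false b = +-identityʳ _
  inclusion–exclusion true  b = refl
  ∣S∩T∣≡0 : ∑ n (λ y → ind (S y ∧ T y)) ≡ 0
  ∣S∩T∣≡0 = +-cancelˡ-≡ ∣ S ∪ T ∣ _ 0 (begin
    ∣ S ∪ T ∣ + ∑ n (λ y → ind (S y ∧ T y))   ≡⟨ sym (∑-distrib-+ n _ _) ⟩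
    ∑ n (λ y → ind ((S ∪ T) y) + ind (S y ∧ T y))
      ≡⟨ ∑-cong n (λ y → inclusion–exclusion (S y) (T y)) ⟩
    ∑ n (λ y → ind (S y) + ind (T y))         ≡⟨ ∑-distrib-+ n _ _ ⟩
    ∣ S ∣ + ∣ T ∣                             ≡⟨ sym eq ⟩
    ∣ S ∪ T ∣                                 ≡⟨ sym (+-identityʳ _) ⟩
    ∣ S ∪ T ∣ + 0                             ∎)
    where open ≡-Reasoning

Disjoint-sym : ∀ {n} {A B : Subset n} → Disjoint A B → Disjoint B A
Disjoint-sym {A = A} {B} A∩B≡∅ v = trans (∧-comm (B v) (A v)) (A∩B≡∅ v)

opposite-faces-disjoint : ∀ {n} {A B : Subset n} i → (∀ v → A v ≡ true → lookup v i ≡ false) →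
  (∀ v → B v ≡ true → lookup v i ≡ true) → Disjoint A B
opposite-faces-disjoint {A = A} {B} i A⊆ B⊆ v with A v in A∋v | B v in B∋v
... | false | _     = refl
... | true  | false = refl
... | true  | true  = ⊥-elim (Bool.not-¬ refl (trans (sym (A⊆ v A∋v)) (B⊆ v B∋v)))

M-∁ : ∀ {n} (S : Subset n) i → M (∁ S) i + M S i ≡ M full i
M-∁ {n} S i = trans (sym (∑-distrib-+ n _ _)) (∑-cong n (λ x → split (S x) (lookup x i)))
  where
  split : ∀ a b → ind (not a ∧ b) + ind (a ∧ b) ≡ ind b
  split false b = +-identityʳ _
  split true  b = refl

M-head : ∀ {n} (S : Subset (suc n)) → M S zero ≡ ∣ S ∘ (true ∷_) ∣
M-head {n} S = cong₂ _+_
  (trans (∑-cong n (λ x → cong ind (∧-zeroʳ (S (false ∷ x))))) (∑-zero n))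
  (∑-cong n (λ x → cong ind (∧-identityʳ (S (true ∷ x)))))

M-suc-split : ∀ {m} (S : Subset (suc m)) c i → M S (suc i) ≡ M (S ∘ (c ∷_)) i + M (S ∘ (not c ∷_)) i
M-suc-split S false i = refl
M-suc-split S true  i = +-comm (M (S ∘ (false ∷_)) i) _

2*M-full : ∀ {n} (i : Fin n) → 2 * M full i ≡ 2 ^ n
2*M-full {suc n} zero = cong (2 *_) (trans (M-head {n} full) (trans (∑-const n 1) (*-identityˡ _)))
2*M-full {suc n} (suc i) = begin
  2 * (M full i + M full i)         ≡⟨ *-distribˡ-+ 2 (M full i) _ ⟩
  2 * M full i + 2 * M full i       ≡⟨ cong₂ _+_ (2*M-full i) (2*M-full i) ⟩
  2 ^ n + 2 ^ n                     ≡⟨ cong (2 ^ n +_) (sym (+-identityʳ _)) ⟩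
  2 ^ suc n                         ∎
  where open ≡-Reasoning

empty-face⇒⊆opposite : ∀ {m} (S : Subset (suc m)) c → (∀ y → S (c ∷ y) ≡ false) →
  ∀ v → S v ≡ true → lookup v zero ≡ not c
empty-face⇒⊆opposite S false empty (false ∷ y) S∋v = ⊥-elim (Bool.not-¬ refl (trans (sym (empty y)) S∋v))
empty-face⇒⊆opposite S false empty (true ∷ y)  S∋v = refl
empty-face⇒⊆opposite S true  empty (false ∷ y) S∋v = refl
empty-face⇒⊆opposite S true  empty (true ∷ y)  S∋v = ⊥-elim (Bool.not-¬ refl (trans (sym (empty y)) S∋v))

bool-cases : ∀ b c → b ≡ c ⊎ b ≡ not c
bool-cases false false = inj₁ refl
bool-cases true  true  = inj₁ refl
bool-cases false true  = inj₂ refl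
bool-cases true  false = inj₂ refl

-- Initial segments

<⇒<ᵇ≡true : ∀ {a b} → a < b → (a <ᵇ b) ≡ true
<⇒<ᵇ≡true a<b = Equivalence.to Bool.T-≡ (<⇒<ᵇ a<b)

≥⇒<ᵇ≡false : ∀ {a b} → b ≤ a → (a <ᵇ b) ≡ false
≥⇒<ᵇ≡false {a} {b} b≤a with a <ᵇ b in eq
... | false = refl
... | true  = ⊥-elim (<⇒≱ (<ᵇ⇒< a b (subst Data.Bool.T (sym eq) _)) b≤a)

+-<ᵇ : ∀ a b k → (a + b <ᵇ k) ≡ (b <ᵇ k ∸ a)
+-<ᵇ zero    b k       = refl
+-<ᵇ (suc a) b zero    = refl
+-<ᵇ (suc a) b (suc k) = +-<ᵇ a b k

val<2^n : ∀ {n} (x : Q n) → val x < 2 ^ n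
val<2^n {zero}  []          = s≤s z≤n
val<2^n {suc n} (false ∷ x) = ≤-trans (val<2^n x) (m≤m+n (2 ^ n) _)
val<2^n {suc n} (true ∷ x)  = subst (λ t → 2 ^ n + val x < 2 ^ n + t) (sym (+-identityʳ (2 ^ n)))
                                    (+-monoʳ-< (2 ^ n) (val<2^n x))

val-zeros : ∀ n → val (replicate n false) ≡ 0
val-zeros zero    = refl
val-zeros (suc n) = val-zeros n

I-full : ∀ {n} k → 2 ^ n ≤ k → I {n} k ≐ full
I-full k 2^n≤k x = <⇒<ᵇ≡true (<-≤-trans (val<2^n x) 2^n≤k)

I-upper : ∀ {n} k (x : Q n) → I {suc n} k (true ∷ x) ≡ I (k ∸ 2 ^ n) x
I-upper {n} k x = +-<ᵇ (2 ^ n) (val x) k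

I-upper-low : ∀ {n} k → k ≤ 2 ^ n → ∀ (x : Q n) → I {suc n} k (true ∷ x) ≡ false
I-upper-low {n} k k≤2^n x = trans (I-upper k x) (cong (λ t → I t x) (m≤n⇒m∸n≡0 k≤2^n))

I-upper-high : ∀ {n} k′ (x : Q n) → I {suc n} (2 ^ n + k′) (true ∷ x) ≡ I k′ x
I-upper-high {n} k′ x = trans (I-upper (2 ^ n + k′) x) (cong (λ t → I t x) (m+n∸m≡n (2 ^ n) k′))

I-lower-high : ∀ {n} k′ (x : Q n) → I {suc n} (2 ^ n + k′) (false ∷ x) ≡ true
I-lower-high {n} k′ = I-full (2 ^ n + k′) (m≤m+n (2 ^ n) k′)

I-⊆lower : ∀ {n} s → s ≤ 2 ^ n → ∀ (x : Q (suc n)) → I s x ≡ true → lookup x zero ≡ false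
I-⊆lower s s≤H (false ∷ x) _   = refl
I-⊆lower s s≤H (true ∷ x)  I∋x = ⊥-elim (Bool.not-¬ refl (trans (sym I∋x) (I-upper-low s s≤H x)))

≤-double : ∀ {k H} → k ≤ H → k ≤ 2 * H
≤-double {H = H} k≤H = ≤-trans k≤H (m≤m+n H _)

data Halves (H k : ℕ) : Set where
  lower : k ≤ H → Halves H k
  upper : ∀ k′ → k′ ≤ H → k ≡ H + k′ → Halves H k

halves : ∀ H k → k ≤ 2 * H → Halves H k
halves H k k≤2H with k ≤? H
... | yes k≤H = lower k≤H
... | no  k≰H = upper (k ∸ H) k∸H≤H (sym (m+[n∸m]≡n H≤k))
  where
  H≤k : H ≤ k
  H≤k = <⇒≤ (≰⇒> k≰H)
  k∸H≤H : k ∸ H ≤ H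
  k∸H≤H = +-cancelˡ-≤ H _ _ (begin
    H + (k ∸ H) ≡⟨ m+[n∸m]≡n H≤k ⟩
    k           ≤⟨ k≤2H ⟩
    2 * H       ≡⟨ cong (H +_) (+-identityʳ H) ⟩
    H + H       ∎)
    where open ≤-Reasoning

∣I∣ : ∀ n k → k ≤ 2 ^ n → ∣ I {n} k ∣ ≡ k
∣I∣ zero zero          _ = refl
∣I∣ zero (suc zero)    _ = refl
∣I∣ zero (suc (suc k)) (s≤s ())
∣I∣ (suc n) k k≤2^n with halves (2 ^ n) k k≤2^n
... | lower k≤H = begin
  ∣ I {n} k ∣ + ∣ I {suc n} k ∘ (true ∷_) ∣
    ≡⟨ cong₂ _+_ (∣I∣ n k k≤H) (∣∣-cong (I-upper-low {n} k k≤H)) ⟩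
  k + ∑ n (λ _ → 0)    ≡⟨ cong (k +_) (∑-zero n) ⟩
  k + 0                ≡⟨ +-identityʳ k ⟩
  k                    ∎
  where open ≡-Reasoning
... | upper k′ k′≤H refl = cong₂ _+_
  (trans (∣∣-cong (I-lower-high {n} k′)) (trans (∑-const n 1) (*-identityˡ _)))
  (trans (∣∣-cong (I-upper-high {n} k′)) (∣I∣ n k′ k′≤H))

cmpl : ∀ {n} → Q n → Q n
cmpl = Data.Vec.map not

val+val-cmpl : ∀ {n} (x : Q n) → suc (val x + val (cmpl x)) ≡ 2 ^ n
val+val-cmpl {zero}  []          = refl
val+val-cmpl {suc n} (b ∷ x) = begin
  suc (val (b ∷ x) + val (cmpl (b ∷ x)))  ≡⟨ cong suc (lead b) ⟩
  suc (2 ^ n + (val x + val (cmpl x)))    ≡⟨ sym (+-suc (2 ^ n) _) ⟩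
  2 ^ n + suc (val x + val (cmpl x))      ≡⟨ cong (2 ^ n +_) (val+val-cmpl x) ⟩
  2 ^ n + 2 ^ n                           ≡⟨ cong (2 ^ n +_) (sym (+-identityʳ (2 ^ n))) ⟩
  2 ^ suc n                               ∎
  where
  open ≡-Reasoning
  lead : ∀ b → val (b ∷ x) + val (cmpl (b ∷ x)) ≡ 2 ^ n + (val x + val (cmpl x))
  lead true  = +-assoc (2 ^ n) (val x) _
  lead false = x∙yz≈y∙xz (val x) (2 ^ n) _

I-cmpl : ∀ {n} k r → k + r ≡ 2 ^ n → ∀ (x : Q n) → I k (cmpl x) ≡ not (I r x)
I-cmpl {n} k r k+r≡2^n x with val x <? r
... | yes x<r = trans (≥⇒<ᵇ≡false k≤x̄) (cong not (sym (<⇒<ᵇ≡true x<r)))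
  where
  k≤x̄ : k ≤ val (cmpl x)
  k≤x̄ = +-cancelʳ-≤ r k _ (begin
    k + r                        ≡⟨ trans k+r≡2^n (sym (val+val-cmpl x)) ⟩
    suc (val x) + val (cmpl x)   ≤⟨ +-monoˡ-≤ (val (cmpl x)) x<r ⟩
    r + val (cmpl x)             ≡⟨ +-comm r _ ⟩
    val (cmpl x) + r             ∎)
    where open ≤-Reasoning
... | no x≮r = trans (<⇒<ᵇ≡true x̄<k) (cong not (sym (≥⇒<ᵇ≡false (≮⇒≥ x≮r))))
  where
  x̄<k : val (cmpl x) < k
  x̄<k = +-cancelʳ-≤ (val x) (suc (val (cmpl x))) k (begin
    suc (val (cmpl x)) + val x   ≡⟨ cong suc (+-comm (val (cmpl x)) (val x)) ⟩
    suc (val x + val (cmpl x))   ≡⟨ trans (val+val-cmpl x) (sym k+r≡2^n) ⟩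
    k + r                        ≤⟨ +-monoʳ-≤ k (≮⇒≥ x≮r) ⟩
    k + val x                    ∎)
    where open ≤-Reasoning

μ : ∀ {n} → Fin n → ℕ → ℕ
μ i k = M (I k) i

μ-zero-lower : ∀ {n} k → k ≤ 2 ^ n → μ {suc n} zero k ≡ 0
μ-zero-lower {n} k k≤H = trans (M-head {n} (I k)) (trans (∣∣-cong (I-upper-low {n} k k≤H)) (∑-zero n))

μ-zero-upper : ∀ {n} k′ → k′ ≤ 2 ^ n → μ {suc n} zero (2 ^ n + k′) ≡ k′
μ-zero-upper {n} k′ k′≤H =
  trans (M-head {n} (I (2 ^ n + k′))) (trans (∣∣-cong (I-upper-high {n} k′)) (∣I∣ n k′ k′≤H))

μ-suc-lower : ∀ {n} (i : Fin n) k → k ≤ 2 ^ n → μ (suc i) k ≡ μ i k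
μ-suc-lower {n} i k k≤H = trans (cong (μ i k +_) (trans (M-cong (I-upper-low {n} k k≤H) i) (∑-zero n)))
                                (+-identityʳ _)

μ-suc-upper : ∀ {n} (i : Fin n) k′ → μ (suc i) (2 ^ n + k′) ≡ M full i + μ i k′
μ-suc-upper {n} i k′ = cong₂ _+_ (M-cong (I-lower-high {n} k′) i) (M-cong (I-upper-high {n} k′) i)

2*μ-suc-upper : ∀ {n} (i : Fin n) k′ → 2 * μ (suc i) (2 ^ n + k′) ≡ 2 ^ n + 2 * μ i k′
2*μ-suc-upper {n} i k′ = begin
  2 * μ (suc i) (2 ^ n + k′)        ≡⟨ cong (2 *_) (μ-suc-upper i k′) ⟩
  2 * (M full i + μ i k′)           ≡⟨ *-distribˡ-+ 2 (M full i) _ ⟩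
  2 * M full i + 2 * μ i k′         ≡⟨ cong (_+ 2 * μ i k′) (2*M-full i) ⟩
  2 ^ n + 2 * μ i k′                ∎
  where open ≡-Reasoning

place : ∀ {n} → Fin n → ℕ
place {suc n} zero    = 2 ^ n
place {suc n} (suc i) = place i

2*place≤2^n : ∀ {n} (i : Fin n) → 2 * place i ≤ 2 ^ n
2*place≤2^n {suc n} zero    = ≤-refl
2*place≤2^n {suc n} (suc i) = ≤-trans (2*place≤2^n i) (m≤m+n (2 ^ n) _)

place≤2^n : ∀ {n} (i : Fin n) → place i ≤ 2 ^ n
place≤2^n i = ≤-trans (m≤m+n (place i) (place i + 0)) (2*place≤2^n i)

place-separated : ∀ {n} {i j : Fin n} → i ≢ j → 2 * place i ≤ place j ⊎ 2 * place j ≤ place i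
place-separated {i = zero}  {zero}  i≢j = ⊥-elim (i≢j refl)
place-separated {i = zero}  {suc j} _   = inj₂ (2*place≤2^n j)
place-separated {i = suc i} {zero}  _   = inj₁ (2*place≤2^n i)
place-separated {i = suc i} {suc j} i≢j = place-separated (i≢j ∘ cong suc)

2*μ≤k : ∀ {n} (i : Fin n) k → k ≤ 2 ^ n → 2 * μ i k ≤ k
2*μ≤k {suc n} i k k≤2^n with halves (2 ^ n) k k≤2^n
2*μ≤k {suc n} zero    k _ | lower k≤H = ≤-trans (≤-reflexive (cong (2 *_) (μ-zero-lower {n} k k≤H))) z≤n
2*μ≤k {suc n} (suc i) k _ | lower k≤H = ≤-trans (≤-reflexive (cong (2 *_) (μ-suc-lower i k k≤H))) (2*μ≤k i k k≤H)
2*μ≤k {suc n} zero    _ _ | upper k′ k′≤H refl = begin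
  2 * μ {suc n} zero (2 ^ n + k′)  ≡⟨ cong (2 *_) (μ-zero-upper {n} k′ k′≤H) ⟩
  2 * k′                           ≡⟨ cong (k′ +_) (+-identityʳ k′) ⟩
  k′ + k′                          ≤⟨ +-monoˡ-≤ k′ k′≤H ⟩
  2 ^ n + k′                       ∎
  where open ≤-Reasoning
2*μ≤k {suc n} (suc i) _ _ | upper k′ k′≤H refl = begin
  2 * μ (suc i) (2 ^ n + k′) ≡⟨ 2*μ-suc-upper i k′ ⟩
  2 ^ n + 2 * μ i k′         ≤⟨ +-monoʳ-≤ (2 ^ n) (2*μ≤k i k′ k′≤H) ⟩
  2 ^ n + k′                 ∎
  where open ≤-Reasoning

k≤place⇒μ≡0 : ∀ {n} (i : Fin n) k → k ≤ place i → μ i k ≡ 0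
k≤place⇒μ≡0 {suc n} zero    k k≤place = μ-zero-lower {n} k k≤place
k≤place⇒μ≡0 {suc n} (suc i) k k≤place =
  trans (μ-suc-lower i k (≤-trans k≤place (place≤2^n i))) (k≤place⇒μ≡0 i k k≤place)

k≤2*μ+place : ∀ {n} (i : Fin n) k → k ≤ 2 ^ n → k ≤ 2 * μ i k + place i
k≤2*μ+place {suc n} i k k≤2^n with halves (2 ^ n) k k≤2^n
k≤2*μ+place {suc n} zero    k _ | lower k≤H =
  subst (λ t → k ≤ 2 * t + 2 ^ n) (sym (μ-zero-lower {n} k k≤H)) k≤H
k≤2*μ+place {suc n} (suc i) k _ | lower k≤H =
  subst (λ t → k ≤ 2 * t + place i) (sym (μ-suc-lower i k k≤H)) (k≤2*μ+place i k k≤H)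
k≤2*μ+place {suc n} zero    _ _ | upper k′ k′≤H refl = begin
  2 ^ n + k′                               ≤⟨ +-monoʳ-≤ (2 ^ n) (m≤m+n k′ (k′ + 0)) ⟩
  2 ^ n + 2 * k′                           ≡⟨ +-comm (2 ^ n) _ ⟩
  2 * k′ + 2 ^ n                           ≡⟨ cong (λ t → 2 * t + 2 ^ n) (sym (μ-zero-upper {n} k′ k′≤H)) ⟩
  2 * μ {suc n} zero (2 ^ n + k′) + 2 ^ n  ∎
  where open ≤-Reasoning
k≤2*μ+place {suc n} (suc i) _ _ | upper k′ k′≤H refl = begin
  2 ^ n + k′                               ≤⟨ +-monoʳ-≤ (2 ^ n) (k≤2*μ+place i k′ k′≤H) ⟩
  2 ^ n + (2 * μ i k′ + place i)           ≡⟨ sym (+-assoc (2 ^ n) _ (place i)) ⟩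
  2 ^ n + 2 * μ i k′ + place i             ≡⟨ cong (_+ place i) (sym (2*μ-suc-upper i k′)) ⟩
  2 * μ (suc i) (2 ^ n + k′) + place i     ∎
  where open ≤-Reasoning

2*k≤2^n+2*μ : ∀ {n} (i : Fin n) k → k ≤ 2 ^ n → 2 * k ≤ 2 ^ n + 2 * μ i k
2*k≤2^n+2*μ {suc n} i k k≤2^n with halves (2 ^ n) k k≤2^n
2*k≤2^n+2*μ {suc n} zero    k _ | lower k≤H = begin
  2 * k                             ≤⟨ *-monoʳ-≤ 2 k≤H ⟩
  2 ^ suc n                         ≤⟨ m≤m+n (2 ^ suc n) _ ⟩
  2 ^ suc n + 2 * μ {suc n} zero k  ∎
  where open ≤-Reasoning
2*k≤2^n+2*μ {suc n} (suc i) k _ | lower k≤H = begin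
  2 * k                          ≤⟨ 2*k≤2^n+2*μ i k k≤H ⟩
  2 ^ n + 2 * μ i k              ≤⟨ +-monoˡ-≤ _ (m≤m+n (2 ^ n) _) ⟩
  2 ^ suc n + 2 * μ i k          ≡⟨ cong (λ t → 2 ^ suc n + 2 * t) (sym (μ-suc-lower i k k≤H)) ⟩
  2 ^ suc n + 2 * μ (suc i) k    ∎
  where open ≤-Reasoning
2*k≤2^n+2*μ {suc n} zero    _ _ | upper k′ k′≤H refl = begin
  2 * (2 ^ n + k′)                             ≡⟨ *-distribˡ-+ 2 (2 ^ n) k′ ⟩
  2 ^ suc n + 2 * k′                           ≡⟨ cong (λ t → 2 ^ suc n + 2 * t) (sym (μ-zero-upper {n} k′ k′≤H)) ⟩
  2 ^ suc n + 2 * μ {suc n} zero (2 ^ n + k′)  ∎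
  where open ≤-Reasoning
2*k≤2^n+2*μ {suc n} (suc i) _ _ | upper k′ k′≤H refl = begin
  2 * (2 ^ n + k′)                        ≡⟨ *-distribˡ-+ 2 (2 ^ n) k′ ⟩
  2 ^ suc n + 2 * k′                      ≤⟨ +-monoʳ-≤ (2 ^ suc n) (2*k≤2^n+2*μ i k′ k′≤H) ⟩
  2 ^ suc n + (2 ^ n + 2 * μ i k′)        ≡⟨ cong (2 ^ suc n +_) (sym (2*μ-suc-upper i k′)) ⟩
  2 ^ suc n + 2 * μ (suc i) (2 ^ n + k′)  ∎
  where open ≤-Reasoning

k∸2*μ+k≤2^n : ∀ {n} (u : Fin (suc n)) k → u ≢ zero → k ≤ 2 ^ n → k ∸ 2 * μ u k + k ≤ 2 ^ n
k∸2*μ+k≤2^n zero     k u≢0 _   = ⊥-elim (u≢0 refl)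
k∸2*μ+k≤2^n {n} (suc u) k _ k≤H = +-cancelʳ-≤ (2 * μ (suc u) k) _ _ (begin
  k ∸ 2 * μ (suc u) k + k + 2 * μ (suc u) k    ≡⟨ xy∙z≈xz∙y (k ∸ 2 * μ (suc u) k) k _ ⟩
  k ∸ 2 * μ (suc u) k + 2 * μ (suc u) k + k    ≡⟨ cong (_+ k) (m∸n+n≡m (2*μ≤k (suc u) k (≤-double k≤H))) ⟩
  k + k                                        ≡⟨ cong (k +_) (sym (+-identityʳ k)) ⟩
  2 * k                                        ≤⟨ 2*k≤2^n+2*μ u k k≤H ⟩
  2 ^ n + 2 * μ u k                            ≡⟨ cong (λ t → 2 ^ n + 2 * t) (sym (μ-suc-lower u k k≤H)) ⟩
  2 ^ n + 2 * μ (suc u) k                      ∎)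
  where open ≤-Reasoning

I-unique : ∀ n (S : Subset n) k → k ≤ 2 ^ n → ∣ S ∣ ≡ k → (∀ i → M S i ≡ μ i k) → S ≐ I k
I-unique zero S zero          _        ∣S∣≡0 _ [] = ind≡0⇒false ∣S∣≡0
I-unique zero S (suc zero)    _        ∣S∣≡1 _ [] = ind≡1⇒true ∣S∣≡1
I-unique zero S (suc (suc k)) (s≤s ()) _     _ []
I-unique (suc n) S k k≤2^n ∣S∣≡k M≡μ with halves (2 ^ n) k k≤2^n
... | lower k≤H = S≐I
  where
  S↓ S↑ : Subset n
  S↓ = S ∘ (false ∷_)
  S↑ = S ∘ (true ∷_)
  S↑≐∅ : ∀ x → S↑ x ≡ false
  S↑≐∅ = ∣∣≡0⇒empty S↑ (trans (sym (M-head S)) (trans (M≡μ zero) (μ-zero-lower {n} k k≤H)))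
  M↑≡0 : ∀ i → M S↑ i ≡ 0
  M↑≡0 i = trans (M-cong S↑≐∅ i) (∑-zero n)
  ∣S↓∣≡k : ∣ S↓ ∣ ≡ k
  ∣S↓∣≡k = trans (sym (+-identityʳ _))
                 (trans (cong (∣ S↓ ∣ +_) (sym (trans (∣∣-cong S↑≐∅) (∑-zero n)))) ∣S∣≡k)
  M↓≡μ : ∀ i → M S↓ i ≡ μ i k
  M↓≡μ i = trans (sym (+-identityʳ _)) (trans (cong (M S↓ i +_) (sym (M↑≡0 i)))
                                              (trans (M≡μ (suc i)) (μ-suc-lower i k k≤H)))
  S≐I : S ≐ I k
  S≐I (false ∷ x) = I-unique n S↓ k k≤H ∣S↓∣≡k M↓≡μ x
  S≐I (true ∷ x)  = trans (S↑≐∅ x) (sym (I-upper-low {n} k k≤H x))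
... | upper k′ k′≤H refl = S≐I
  where
  S↓ S↑ : Subset n
  S↓ = S ∘ (false ∷_)
  S↑ = S ∘ (true ∷_)
  ∣S↑∣≡k′ : ∣ S↑ ∣ ≡ k′
  ∣S↑∣≡k′ = trans (sym (M-head S)) (trans (M≡μ zero) (μ-zero-upper {n} k′ k′≤H))
  S↓≐full : S↓ ≐ full
  S↓≐full = ∣∣≡2^n⇒full S↓ (+-cancelʳ-≡ k′ _ _ (trans (cong (∣ S↓ ∣ +_) (sym ∣S↑∣≡k′)) ∣S∣≡k))
  M↑≡μ : ∀ i → M S↑ i ≡ μ i k′
  M↑≡μ i = +-cancelˡ-≡ (M full i) _ _ (begin
    M full i + M S↑ i   ≡⟨ cong (_+ M S↑ i) (sym (M-cong S↓≐full i)) ⟩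
    M S (suc i)         ≡⟨ M≡μ (suc i) ⟩
    μ (suc i) (2 ^ n + k′) ≡⟨ μ-suc-upper i k′ ⟩
    M full i + μ i k′   ∎)
    where open ≡-Reasoning
  S≐I : S ≐ I (2 ^ n + k′)
  S≐I (false ∷ x) = trans (S↓≐full x) (sym (I-lower-high {n} k′ x))
  S≐I (true ∷ x)  = trans (I-unique n S↑ k′ k′≤H ∣S↑∣≡k′ M↑≡μ x) (sym (I-upper-high {n} k′ x))

-- Cube symmetries

lookup-ext : ∀ {n} {x y : Q n} → (∀ i → lookup x i ≡ lookup y i) → x ≡ y
lookup-ext = Pointwise-≡⇒≡ ∘ ext

xor-cancelʳ : ∀ a b → (a xor b) xor b ≡ a
xor-cancelʳ a b = trans (Bool.xor-assoc a b b) (trans (cong (a xor_) (Bool.xor-same b)) (Bool.xor-identityʳ a))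

xor≡ʳ⇒false : ∀ a c → a xor c ≡ c → a ≡ false
xor≡ʳ⇒false false c _  = refl
xor≡ʳ⇒false true  c eq = ⊥-elim (Bool.not-¬ refl (sym (trans (sym (Bool.true-xor c)) eq)))

-- Every automorphism of Q n is of this form (automorphism-image).
record CubeSym (n : ℕ) : Set where
  constructor cubeSym
  field
    perm  : Permutation′ n
    flips : Q n
open CubeSym

act : ∀ {n} → CubeSym n → Q n → Q n
act E x = tabulate (λ i → lookup x (perm E ⟨$⟩ʳ i) xor lookup (flips E) i)

lookup-act : ∀ {n} (E : CubeSym n) x i → lookup (act E x) i ≡ lookup x (perm E ⟨$⟩ʳ i) xor lookup (flips E) i
lookup-act E x i = lookup∘tabulate _ i

inv : ∀ {n} → CubeSym n → CubeSym n
inv E = cubeSym (Perm.flip (perm E)) (tabulate (λ i → lookup (flips E) (perm E ⟨$⟩ˡ i)))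

lookup-act-inv : ∀ {n} (E : CubeSym n) y i →
  lookup (act (inv E) y) i ≡ lookup y (perm E ⟨$⟩ˡ i) xor lookup (flips E) (perm E ⟨$⟩ˡ i)
lookup-act-inv E y i = trans (lookup-act (inv E) y i) (cong (lookup y (perm E ⟨$⟩ˡ i) xor_) (lookup∘tabulate _ i))

act-inv-act : ∀ {n} (E : CubeSym n) x → act (inv E) (act E x) ≡ x
act-inv-act E x = lookup-ext λ i → begin
  lookup (act (inv E) (act E x)) i
    ≡⟨ lookup-act-inv E (act E x) i ⟩
  lookup (act E x) (π⁻¹ i) xor lookup (flips E) (π⁻¹ i)
    ≡⟨ cong (_xor lookup (flips E) (π⁻¹ i)) (lookup-act E x (π⁻¹ i)) ⟩
  (lookup x (π (π⁻¹ i)) xor lookup (flips E) (π⁻¹ i)) xor lookup (flips E) (π⁻¹ i)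
    ≡⟨ xor-cancelʳ _ _ ⟩
  lookup x (π (π⁻¹ i))
    ≡⟨ cong (lookup x) (inverseʳ (perm E)) ⟩
  lookup x i ∎
  where
  open ≡-Reasoning
  π = perm E ⟨$⟩ʳ_
  π⁻¹ = perm E ⟨$⟩ˡ_

act-act-inv : ∀ {n} (E : CubeSym n) y → act E (act (inv E) y) ≡ y
act-act-inv E y = lookup-ext λ i → begin
  lookup (act E (act (inv E) y)) i
    ≡⟨ lookup-act E (act (inv E) y) i ⟩
  lookup (act (inv E) y) (π i) xor lookup (flips E) i
    ≡⟨ cong (_xor lookup (flips E) i) (lookup-act-inv E y (π i)) ⟩
  (lookup y (π⁻¹ (π i)) xor lookup (flips E) (π⁻¹ (π i))) xor lookup (flips E) i
    ≡⟨ cong (λ j → (lookup y j xor lookup (flips E) j) xor lookup (flips E) i) (inverseˡ (perm E)) ⟩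
  (lookup y i xor lookup (flips E) i) xor lookup (flips E) i
    ≡⟨ xor-cancelʳ _ _ ⟩
  lookup y i ∎
  where
  open ≡-Reasoning
  π = perm E ⟨$⟩ʳ_
  π⁻¹ = perm E ⟨$⟩ˡ_

act-inv-unique : ∀ {n} (E : CubeSym n) {x y} → act E x ≡ y → act (inv E) y ≡ x
act-inv-unique E {x} refl = act-inv-act E x

act-injective : ∀ {n} (E : CubeSym n) {x y} → act E x ≡ act E y → x ≡ y
act-injective E {x} {y} eq = trans (sym (act-inv-act E x)) (trans (cong (act (inv E)) eq) (act-inv-act E y))

act-inv-inv : ∀ {n} (E : CubeSym n) x → act (inv (inv E)) x ≡ act E x
act-inv-inv E x = act-inv-unique (inv E) (act-inv-act E x)

img : ∀ {n} → CubeSym n → Subset n → Subset n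
img E S = S ∘ act (inv E)

img-cong : ∀ {n} (E : CubeSym n) {S T : Subset n} → S ≐ T → img E S ≐ img E T
img-cong E S≐T = S≐T ∘ act (inv E)

img-img-inv : ∀ {n} (E : CubeSym n) (S : Subset n) → img E (img (inv E) S) ≐ S
img-img-inv E S y = cong S (trans (act-inv-inv E (act (inv E) y)) (act-act-inv E y))

img-inv-img : ∀ {n} (E : CubeSym n) (S : Subset n) → img (inv E) (img E S) ≐ S
img-inv-img E S y = cong S (trans (cong (act (inv E)) (act-inv-inv E y)) (act-inv-act E y))

seg : ∀ {n} → CubeSym n → ℕ → Subset n
seg E s = img E (I s)

∣img∣ : ∀ {n} (E : CubeSym n) (S : Subset n) → ∣ img E S ∣ ≡ ∣ S ∣
∣img∣ {n} E S = ∑-reindex n (act (inv E)) (act E) (act-act-inv E) (act-inv-act E) (ind ∘ S)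

∣seg∣ : ∀ {n} (E : CubeSym n) s → s ≤ 2 ^ n → ∣ seg E s ∣ ≡ s
∣seg∣ {n} E s s≤2^n = trans (∣img∣ E (I s)) (∣I∣ n s s≤2^n)

M-img : ∀ {n} (E : CubeSym n) (S : Subset n) i →
  M (img E S) i ≡ ∑ n (λ x → ind (S x ∧ (lookup x (perm E ⟨$⟩ʳ i) xor lookup (flips E) i)))
M-img {n} E S i = begin
  M (img E S) i
    ≡⟨ sym (∑-reindex n (act E) (act (inv E)) (act-inv-act E) (act-act-inv E) _) ⟩
  ∑ n (λ x → ind (S (act (inv E) (act E x)) ∧ lookup (act E x) i))
    ≡⟨ ∑-cong n (λ x → cong₂ (λ y b → ind (S y ∧ b)) (act-inv-act E x) (lookup-act E x i)) ⟩
  ∑ n (λ x → ind (S x ∧ (lookup x (perm E ⟨$⟩ʳ i) xor lookup (flips E) i))) ∎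
  where open ≡-Reasoning

M-img-unflipped : ∀ {n} (E : CubeSym n) (S : Subset n) i → lookup (flips E) i ≡ false →
  M (img E S) i ≡ M S (perm E ⟨$⟩ʳ i)
M-img-unflipped {n} E S i cᵢ≡false = trans (M-img E S i) (∑-cong n λ x →
  cong (λ b → ind (S x ∧ b)) (trans (cong (lookup x (perm E ⟨$⟩ʳ i) xor_) cᵢ≡false) (Bool.xor-identityʳ _)))

M-img-flipped : ∀ {n} (E : CubeSym n) (S : Subset n) i → lookup (flips E) i ≡ true →
  M (img E S) i + M S (perm E ⟨$⟩ʳ i) ≡ ∣ S ∣
M-img-flipped {n} E S i cᵢ≡true = begin
  M (img E S) i + M S j                                                  ≡⟨ cong (_+ M S j) (M-img E S i) ⟩
  ∑ n (λ x → ind (S x ∧ (lookup x j xor lookup (flips E) i))) + M S j    ≡⟨ sym (∑-distrib-+ n _ _) ⟩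
  ∑ n (λ x → ind (S x ∧ (lookup x j xor lookup (flips E) i)) + ind (S x ∧ lookup x j))
    ≡⟨ ∑-cong n (λ x → trans (cong (λ c → ind (S x ∧ (lookup x j xor c)) + ind (S x ∧ lookup x j)) cᵢ≡true)
                              (split (S x) (lookup x j))) ⟩
  ∣ S ∣                                                                  ∎
  where
  open ≡-Reasoning
  j = perm E ⟨$⟩ʳ i
  split : ∀ a b → ind (a ∧ (b xor true)) + ind (a ∧ b) ≡ ind a
  split false b     = refl
  split true  false = refl
  split true  true  = refl

M-img-cong : ∀ {n} (E : CubeSym n) {S T : Subset n} → ∣ S ∣ ≡ ∣ T ∣ → (∀ j → M S j ≡ M T j) →
  ∀ i → M (img E S) i ≡ M (img E T) i
M-img-cong E {S} {T} ∣S∣≡∣T∣ M≡ i with lookup (flips E) i in cᵢ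
... | false = trans (M-img-unflipped E S i cᵢ) (trans (M≡ _) (sym (M-img-unflipped E T i cᵢ)))
... | true  = +-cancelʳ-≡ (M S j) _ _ (begin
  M (img E S) i + M S j   ≡⟨ M-img-flipped E S i cᵢ ⟩
  ∣ S ∣                   ≡⟨ ∣S∣≡∣T∣ ⟩
  ∣ T ∣                   ≡⟨ sym (M-img-flipped E T i cᵢ) ⟩
  M (img E T) i + M T j   ≡⟨ cong (M (img E T) i +_) (sym (M≡ j)) ⟩
  M (img E T) i + M S j   ∎)
  where
  open ≡-Reasoning
  j = perm E ⟨$⟩ʳ i

segment-image-unique : ∀ {n} (E : CubeSym n) (S : Subset n) k → k ≤ 2 ^ n → ∣ S ∣ ≡ k →
  (∀ i → M S i ≡ M (seg E k) i) → S ≐ seg E k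
segment-image-unique {n} E S k k≤2^n ∣S∣≡k M≡ y = begin
  S y                            ≡⟨ sym (img-img-inv E S y) ⟩
  img E (img (inv E) S) y        ≡⟨ img-cong E S′≐I y ⟩
  seg E k y                      ∎
  where
  open ≡-Reasoning
  S′ = img (inv E) S
  M-S′ : ∀ i → M S′ i ≡ μ i k
  M-S′ i = trans (M-img-cong (inv E) (trans ∣S∣≡k (sym (trans (∣img∣ E (I k)) (∣I∣ n k k≤2^n)))) M≡ i)
                 (M-cong (img-inv-img E (I k)) i)
  S′≐I : S′ ≐ I k
  S′≐I = I-unique n S′ k k≤2^n (trans (∣img∣ (inv E) S) ∣S∣≡k) M-S′

_⊙_ : ∀ {n} → CubeSym n → CubeSym n → CubeSym n
G ⊙ E = cubeSym (perm G ∘ₚ perm E) (tabulate (λ i → lookup (flips E) (perm G ⟨$⟩ʳ i) xor lookup (flips G) i))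

act-⊙ : ∀ {n} (G E : CubeSym n) x → act (G ⊙ E) x ≡ act G (act E x)
act-⊙ G E x = lookup-ext pointwise
  where
  open ≡-Reasoning
  pointwise : ∀ i → lookup (act (G ⊙ E) x) i ≡ lookup (act G (act E x)) i
  pointwise i = begin
    lookup (act (G ⊙ E) x) i
      ≡⟨ lookup-act (G ⊙ E) x i ⟩
    lookup x (perm E ⟨$⟩ʳ j) xor lookup (flips (G ⊙ E)) i
      ≡⟨ cong (lookup x (perm E ⟨$⟩ʳ j) xor_) (lookup∘tabulate _ i) ⟩
    lookup x (perm E ⟨$⟩ʳ j) xor (lookup (flips E) j xor lookup (flips G) i)
      ≡⟨ sym (Bool.xor-assoc (lookup x (perm E ⟨$⟩ʳ j)) _ _) ⟩
    (lookup x (perm E ⟨$⟩ʳ j) xor lookup (flips E) j) xor lookup (flips G) i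
      ≡⟨ cong (_xor lookup (flips G) i) (sym (lookup-act E x j)) ⟩
    lookup (act E x) j xor lookup (flips G) i
      ≡⟨ sym (lookup-act G (act E x) i) ⟩
    lookup (act G (act E x)) i ∎
    where j = perm G ⟨$⟩ʳ i

img-⊙ : ∀ {n} (G E : CubeSym n) (S : Subset n) → img G (img E S) ≐ img (G ⊙ E) S
img-⊙ G E S y = cong S (sym (act-inv-unique (G ⊙ E) (begin
  act (G ⊙ E) (act (inv E) (act (inv G) y))   ≡⟨ act-⊙ G E (act (inv E) (act (inv G) y)) ⟩
  act G (act E (act (inv E) (act (inv G) y))) ≡⟨ cong (act G) (act-act-inv E (act (inv G) y)) ⟩
  act G (act (inv G) y)                       ≡⟨ act-act-inv G y ⟩
  y                                           ∎)))
  where open ≡-Reasoning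

img-⊙-act : ∀ {n} (G E : CubeSym n) (S : Subset n) v → img (G ⊙ E) S (act G v) ≡ img E S v
img-⊙-act G E S v = trans (sym (img-⊙ G E S (act G v))) (cong (img E S) (act-inv-act G v))

permutation-injective : ∀ {n} (π : Permutation′ n) {i j} → π ⟨$⟩ʳ i ≡ π ⟨$⟩ʳ j → i ≡ j
permutation-injective π eq = trans (sym (inverseˡ π)) (trans (cong (π ⟨$⟩ˡ_) eq) (inverseˡ π))

permute : ∀ {n} → Permutation′ n → CubeSym n
permute τ = cubeSym τ (replicate _ false)

M-img-permute : ∀ {n} (τ : Permutation′ n) (S : Subset n) i → M (img (permute τ) S) i ≡ M S (τ ⟨$⟩ʳ i)
M-img-permute τ S i = M-img-unflipped (permute τ) S i (lookup-replicate i false)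

M-img-permute-⊙ : ∀ {n} (τ : Permutation′ n) (E : CubeSym n) (S : Subset n) i →
  M (img (permute τ ⊙ E) S) i ≡ M (img E S) (τ ⟨$⟩ʳ i)
M-img-permute-⊙ τ E S i = trans (M-cong (sym ∘ img-⊙ (permute τ) E S) i) (M-img-permute τ (img E S) i)

identity : ∀ {n} → CubeSym n
identity = permute Perm.id

img-identity : ∀ {n} (S : Subset n) → img identity S ≐ S
img-identity S y = cong S (lookup-ext λ i → begin
  lookup (act (inv identity) y) i                       ≡⟨ lookup-act-inv identity y i ⟩
  lookup y i xor lookup (replicate _ false) i           ≡⟨ cong (lookup y i xor_) (lookup-replicate i false) ⟩
  lookup y i xor false                                  ≡⟨ Bool.xor-identityʳ _ ⟩
  lookup y i                                            ∎)
  where open ≡-Reasoning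

complement : ∀ {n} → CubeSym n → CubeSym n
complement E = cubeSym (perm E) (Data.Vec.map not (flips E))

seg-complement : ∀ {n} (E : CubeSym n) k r → k + r ≡ 2 ^ n → seg (complement E) k ≐ ∁ (seg E r)
seg-complement E k r k+r≡2^n y = trans (cong (I k) act-inv-complement) (I-cmpl k r k+r≡2^n (act (inv E) y))
  where
  open ≡-Reasoning
  act-inv-complement : act (inv (complement E)) y ≡ cmpl (act (inv E) y)
  act-inv-complement = lookup-ext λ i → begin
    lookup (act (inv (complement E)) y) i
      ≡⟨ lookup-act-inv (complement E) y i ⟩
    lookup y (perm E ⟨$⟩ˡ i) xor lookup (Data.Vec.map not (flips E)) (perm E ⟨$⟩ˡ i)
      ≡⟨ cong (lookup y (perm E ⟨$⟩ˡ i) xor_) (Vec.lookup-map (perm E ⟨$⟩ˡ i) not (flips E)) ⟩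
    lookup y (perm E ⟨$⟩ˡ i) xor not (lookup (flips E) (perm E ⟨$⟩ˡ i))
      ≡⟨ sym (Bool.not-distribʳ-xor (lookup y (perm E ⟨$⟩ˡ i)) (lookup (flips E) (perm E ⟨$⟩ˡ i))) ⟩
    not (lookup y (perm E ⟨$⟩ˡ i) xor lookup (flips E) (perm E ⟨$⟩ˡ i))
      ≡⟨ cong not (sym (lookup-act-inv E y i)) ⟩
    not (lookup (act (inv E) y) i)
      ≡⟨ sym (Vec.lookup-map i not (act (inv E) y)) ⟩
    lookup (cmpl (act (inv E) y)) i ∎

seg-complement-identity : ∀ {n} k r → k + r ≡ 2 ^ n → seg (complement identity) r ≐ ∁ (I {n} k)
seg-complement-identity k r k+r≡2^n y = trans (seg-complement identity r k (trans (+-comm r k) k+r≡2^n) y)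
                                (cong not (img-identity (I k) y))

restrict : ∀ {n} → CubeSym (suc n) → CubeSym n
restrict E = cubeSym (remove zero (perm E)) (tail (flips E))

lookup-tail : ∀ {n} (v : Q (suc n)) i → lookup v (suc i) ≡ lookup (tail v) i
lookup-tail (_ ∷ _) i = refl

module _ {n} (E : CubeSym (suc n)) (π0≡0 : perm E ⟨$⟩ʳ zero ≡ zero) where

  act-∷ : ∀ b x → act E (b ∷ x) ≡ (b xor lookup (flips E) zero) ∷ act (restrict E) x
  act-∷ b x = lookup-ext pointwise
    where
    open ≡-Reasoning
    pointwise : ∀ i → lookup (act E (b ∷ x)) i ≡ lookup ((b xor lookup (flips E) zero) ∷ act (restrict E) x) i
    pointwise zero = trans (lookup-act E (b ∷ x) zero) (cong (λ j → lookup (b ∷ x) j xor lookup (flips E) zero) π0≡0)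
    pointwise (suc i) = begin
      lookup (act E (b ∷ x)) (suc i)
        ≡⟨ lookup-act E (b ∷ x) (suc i) ⟩
      lookup (b ∷ x) (perm E ⟨$⟩ʳ suc i) xor lookup (flips E) (suc i)
        ≡⟨ cong₂ (λ j c → lookup (b ∷ x) j xor c) (sym (lift₀-remove (perm E) π0≡0 (suc i))) (lookup-tail (flips E) i) ⟩
      lookup x (remove zero (perm E) ⟨$⟩ʳ i) xor lookup (tail (flips E)) i
        ≡⟨ sym (lookup-act (restrict E) x i) ⟩
      lookup (act (restrict E) x) i ∎

  img-∷ : ∀ (S : Subset (suc n)) b y →
          img E S (b ∷ y) ≡ S ((b xor lookup (flips E) zero) ∷ act (inv (restrict E)) y)
  img-∷ S b y = cong S (act-inv-unique E (begin
    act E ((b xor c₀) ∷ y′)                     ≡⟨ act-∷ (b xor c₀) y′ ⟩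
    ((b xor c₀) xor c₀) ∷ act (restrict E) y′   ≡⟨ cong₂ _∷_ (xor-cancelʳ b c₀) (act-act-inv (restrict E) y) ⟩
    b ∷ y                                       ∎))
    where
    open ≡-Reasoning
    c₀ = lookup (flips E) zero
    y′ = act (inv (restrict E)) y

transpose-at-second : ∀ {n} (i j : Fin n) → PC.transpose i j j ≡ i
transpose-at-second i j with j Fin.≟ i
... | yes j≡i = j≡i
... | no  _ with j Fin.≟ j
...   | yes _   = refl
...   | no  j≢j = ⊥-elim (j≢j refl)

transpose-preserves : ∀ {n} {A : Set} (f : Fin n → A) {i j} → f i ≡ f j → ∀ k → f (PC.transpose i j k) ≡ f k
transpose-preserves f {i} {j} fi≡fj k with k Fin.≟ i
... | yes refl = sym fi≡fj
... | no  _ with k Fin.≟ j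
...   | yes refl = fi≡fj
...   | no  _    = refl

fixes⇒invariant : ∀ {n} (S : Subset n) (φ : Q n → Q n) → (∀ {x y} → φ x ≡ φ y → x ≡ y) →
                  (∀ x → S x ≡ true → φ x ≡ x) → (S ∘ φ) ≐ S
fixes⇒invariant S φ φ-injective fixes x with S x in Sx | S (φ x) in Sφx
... | true  | true  = refl
... | false | false = refl
... | true  | false = ⊥-elim (Bool.not-¬ refl (trans (sym Sφx) (trans (cong S (fixes x Sx)) Sx)))
... | false | true  = ⊥-elim (Bool.not-¬ refl (trans (sym Sx) (trans (cong S (sym φx≡x)) Sφx)))
  where
  φx≡x : φ x ≡ x
  φx≡x = φ-injective {φ x} {x} (fixes (φ x) Sφx)

permute-inv-fixes : ∀ {n} (τ : Permutation′ n) z → (∀ i → lookup z (τ ⟨$⟩ˡ i) ≡ lookup z i) →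
                    act (inv (permute τ)) z ≡ z
permute-inv-fixes {n} τ z z∘τ⁻¹≡z = lookup-ext λ i → begin
  lookup (act (inv (permute τ)) z) i
    ≡⟨ lookup-act-inv (permute τ) z i ⟩
  lookup z (τ ⟨$⟩ˡ i) xor lookup (replicate n false) (τ ⟨$⟩ˡ i)
    ≡⟨ cong (lookup z (τ ⟨$⟩ˡ i) xor_) (lookup-replicate (τ ⟨$⟩ˡ i) false) ⟩
  lookup z (τ ⟨$⟩ˡ i) xor false
    ≡⟨ Bool.xor-identityʳ _ ⟩
  lookup z (τ ⟨$⟩ˡ i)
    ≡⟨ z∘τ⁻¹≡z i ⟩
  lookup z i ∎
  where open ≡-Reasoning

transpose-fixes-segment : ∀ {n} s → s ≤ 2 ^ n → ∀ u → (∀ z → I {suc n} s z ≡ true → lookup z u ≡ false) →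
  img (permute (Perm.transpose zero u)) (I s) ≐ I s
transpose-fixes-segment s s≤H u I⊆u = fixes⇒invariant (I s) (act (inv τ)) (act-injective (inv τ)) λ z I∋z →
  permute-inv-fixes (Perm.transpose zero u) z (transpose-preserves (lookup z) (trans (I⊆u z I∋z) (sym (I-⊆lower s s≤H z I∋z))))
  where τ = permute (Perm.transpose zero u)

seg-in-face : ∀ {n} (E : CubeSym (suc n)) s b → 0 < s → (∀ v → seg E s v ≡ true → lookup v zero ≡ b) →
  lookup (flips E) zero ≡ b × (∀ z → I s z ≡ true → lookup z (perm E ⟨$⟩ʳ zero) ≡ false)
seg-in-face {n} E s b 0<s ⊆face = c₀≡b , λ z I∋z →
  xor≡ʳ⇒false (lookup z u) c₀ (trans (sym (lookup-act E z zero)) (trans (⊆face (act E z) (I∋⇒seg∋ z I∋z)) (sym c₀≡b)))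
  where
  u = perm E ⟨$⟩ʳ zero
  c₀ = lookup (flips E) zero
  zeros = replicate (suc n) false
  I∋⇒seg∋ : ∀ z → I s z ≡ true → seg E s (act E z) ≡ true
  I∋⇒seg∋ z I∋z = trans (cong (I s) (act-inv-act E z)) I∋z
  I∋zeros : I s zeros ≡ true
  I∋zeros = trans (cong (_<ᵇ s) (val-zeros (suc n))) (<⇒<ᵇ≡true 0<s)
  c₀≡b : c₀ ≡ b
  c₀≡b = begin
    c₀                          ≡⟨ cong (_xor c₀) (sym (lookup-replicate u false)) ⟩
    lookup zeros u xor c₀       ≡⟨ sym (lookup-act E zeros zero) ⟩
    lookup (act E zeros) zero   ≡⟨ ⊆face (act E zeros) (I∋⇒seg∋ zeros I∋zeros) ⟩
    b                           ∎
    where open ≡-Reasoning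

-- I s lies in the subcube z₀ = z_u = false (u = perm E ⟨$⟩ʳ zero), so composing E with the
-- transposition of 0 and u does not change the image and makes E fix coordinate 0.
face-restriction : ∀ {n} (E : CubeSym (suc n)) s b → s ≤ 2 ^ n →
  (∀ v → seg E s v ≡ true → lookup v zero ≡ b) →
  Σ (CubeSym n) λ E′ → ∀ y → seg E s (b ∷ y) ≡ seg E′ s y
face-restriction E zero     b _   _      = identity , λ _ → refl
face-restriction {n} E (suc s′) b s≤H ⊆face = restrict E₂ , restricted
  where
  s = suc s′
  u = perm E ⟨$⟩ʳ zero
  τ = Perm.transpose zero u
  E₂ = E ⊙ permute τ
  c₀≡b : lookup (flips E) zero ≡ b
  c₀≡b = proj₁ (seg-in-face E s b (s≤s z≤n) ⊆face)
  E₂-fixes-0 : perm E₂ ⟨$⟩ʳ zero ≡ zero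
  E₂-fixes-0 = transpose-at-second zero u
  E₂-flip₀ : lookup (flips E₂) zero ≡ b
  E₂-flip₀ = trans (lookup∘tabulate (λ i → lookup (flips (permute τ)) (perm E ⟨$⟩ʳ i) xor lookup (flips E) i) zero)
                   (trans (cong (_xor lookup (flips E) zero) (lookup-replicate u false)) c₀≡b)
  restricted : ∀ y → seg E s (b ∷ y) ≡ seg (restrict E₂) s y
  restricted y = begin
    seg E s (b ∷ y)
      ≡⟨ img-cong E (sym ∘ transpose-fixes-segment s s≤H u (proj₂ (seg-in-face E s b (s≤s z≤n) ⊆face))) (b ∷ y) ⟩
    img E (img (permute τ) (I s)) (b ∷ y)
      ≡⟨ img-⊙ E (permute τ) (I s) (b ∷ y) ⟩
    seg E₂ s (b ∷ y)
      ≡⟨ img-∷ E₂ E₂-fixes-0 (I s) b y ⟩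
    I s ((b xor lookup (flips E₂) zero) ∷ act (inv (restrict E₂)) y)
      ≡⟨ cong (λ c → I s ((b xor c) ∷ act (inv (restrict E₂)) y)) E₂-flip₀ ⟩
    I s ((b xor b) ∷ act (inv (restrict E₂)) y)
      ≡⟨ cong (λ c → I s (c ∷ act (inv (restrict E₂)) y)) (Bool.xor-same b) ⟩
    seg (restrict E₂) s y ∎
    where open ≡-Reasoning

-- Automorphisms of Q n

flipAt : ∀ {n} → Fin n → Q n → Q n
flipAt i x = Data.Vec.updateAt x i not

lookup-flipAt : ∀ {n} (i : Fin n) x → lookup (flipAt i x) i ≡ not (lookup x i)
lookup-flipAt i x = Vec.lookup∘updateAt i x

lookup-flipAt′ : ∀ {n} {i j : Fin n} x → j ≢ i → lookup (flipAt i x) j ≡ lookup x j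
lookup-flipAt′ {i = i} {j} x j≢i = Vec.lookup∘updateAt′ j i j≢i x

flipAt-involutive : ∀ {n} (i : Fin n) x → flipAt i (flipAt i x) ≡ x
flipAt-involutive i x = trans (Vec.updateAt-updateAt i x) (trans (Vec.updateAt-cong i not-involutive x) (Vec.updateAt-id i x))

hamming-self : ∀ {n} (x : Q n) → hamming x x ≡ 0
hamming-self []          = refl
hamming-self (true ∷ x)  = hamming-self x
hamming-self (false ∷ x) = hamming-self x

hamming≡0⇒≡ : ∀ {n} (x y : Q n) → hamming x y ≡ 0 → x ≡ y
hamming≡0⇒≡ []          []          _  = refl
hamming≡0⇒≡ (true ∷ x)  (true ∷ y)  eq = cong (true ∷_) (hamming≡0⇒≡ x y eq)
hamming≡0⇒≡ (false ∷ x) (false ∷ y) eq = cong (false ∷_) (hamming≡0⇒≡ x y eq)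

hamming-flipAt : ∀ {n} (i : Fin n) x → hamming x (flipAt i x) ≡ 1
hamming-flipAt zero    (true ∷ x)  = cong suc (hamming-self x)
hamming-flipAt zero    (false ∷ x) = cong suc (hamming-self x)
hamming-flipAt (suc i) (true ∷ x)  = hamming-flipAt i x
hamming-flipAt (suc i) (false ∷ x) = hamming-flipAt i x

hamming≡1⇒flipAt : ∀ {n} (x y : Q n) → hamming x y ≡ 1 → Σ (Fin n) λ i → y ≡ flipAt i x
hamming≡1⇒flipAt []          []          ()
hamming≡1⇒flipAt (true ∷ x)  (false ∷ y) eq = zero , cong (false ∷_) (sym (hamming≡0⇒≡ x y (suc-injective eq)))
hamming≡1⇒flipAt (false ∷ x) (true ∷ y)  eq = zero , cong (true ∷_) (sym (hamming≡0⇒≡ x y (suc-injective eq)))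
hamming≡1⇒flipAt (true ∷ x)  (true ∷ y)  eq with hamming≡1⇒flipAt x y eq
... | i , y≡ = suc i , cong (true ∷_) y≡
hamming≡1⇒flipAt (false ∷ x) (false ∷ y) eq with hamming≡1⇒flipAt x y eq
... | i , y≡ = suc i , cong (false ∷_) y≡

_⊕_ : ∀ {n} → Q n → Q n → Q n
_⊕_ = Data.Vec.zipWith _xor_

⊕-cancelʳ : ∀ {n} (x c : Q n) → (x ⊕ c) ⊕ c ≡ x
⊕-cancelʳ []      []      = refl
⊕-cancelʳ (a ∷ x) (b ∷ c) = cong₂ _∷_ (xor-cancelʳ a b) (⊕-cancelʳ x c)

⊕-self : ∀ {n} (c : Q n) → c ⊕ c ≡ replicate n false
⊕-self []      = refl
⊕-self (b ∷ c) = cong₂ _∷_ (Bool.xor-same b) (⊕-self c)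

hamming-⊕ : ∀ {n} (x y c : Q n) → hamming (x ⊕ c) (y ⊕ c) ≡ hamming x y
hamming-⊕ []          []          []          = refl
hamming-⊕ (true ∷ x)  (true ∷ y)  (true ∷ c)  = hamming-⊕ x y c
hamming-⊕ (true ∷ x)  (true ∷ y)  (false ∷ c) = hamming-⊕ x y c
hamming-⊕ (false ∷ x) (false ∷ y) (true ∷ c)  = hamming-⊕ x y c
hamming-⊕ (false ∷ x) (false ∷ y) (false ∷ c) = hamming-⊕ x y c
hamming-⊕ (true ∷ x)  (false ∷ y) (true ∷ c)  = cong suc (hamming-⊕ x y c)
hamming-⊕ (true ∷ x)  (false ∷ y) (false ∷ c) = cong suc (hamming-⊕ x y c)
hamming-⊕ (false ∷ x) (true ∷ y)  (true ∷ c)  = cong suc (hamming-⊕ x y c)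
hamming-⊕ (false ∷ x) (true ∷ y)  (false ∷ c) = cong suc (hamming-⊕ x y c)

weight : ∀ {n} → Q n → ℕ
weight []      = 0
weight (b ∷ x) = ind b + weight x

weight≡0⇒zeros : ∀ {n} (x : Q n) → weight x ≡ 0 → x ≡ replicate n false
weight≡0⇒zeros []          _  = refl
weight≡0⇒zeros (false ∷ x) eq = cong (false ∷_) (weight≡0⇒zeros x eq)

weight≢0⇒one : ∀ {n} (x : Q n) {w} → weight x ≡ suc w → Σ (Fin n) λ i → lookup x i ≡ true
weight≢0⇒one (true ∷ x)  _  = zero , refl
weight≢0⇒one (false ∷ x) eq with weight≢0⇒one x eq
... | i , xᵢ = suc i , xᵢ

weight-flipAt : ∀ {n} (x : Q n) i → lookup x i ≡ true → suc (weight (flipAt i x)) ≡ weight x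
weight-flipAt (true ∷ x)  zero    _  = refl
weight-flipAt (true ∷ x)  (suc i) xᵢ = cong suc (weight-flipAt x i xᵢ)
weight-flipAt (false ∷ x) (suc i) xᵢ = weight-flipAt x i xᵢ

-- For a ≢ b, the only common neighbours of flipAt a z and flipAt b z are z and flipAt a (flipAt b z).
common-neighbour : ∀ {n} (α β a b : Fin n) z → a ≢ b →
  flipAt α (flipAt a z) ≡ flipAt β (flipAt b z) → α ≡ a ⊎ α ≡ b
common-neighbour α β a b z a≢b eq with α Fin.≟ a | α Fin.≟ b
... | yes α≡a | _        = inj₁ α≡a
... | no  _   | yes α≡b  = inj₂ α≡b
... | no  α≢a | no  α≢b  = ⊥-elim (β≢a β≡a)
  where
  at : ∀ j → j ≢ α → lookup (flipAt α (flipAt a z)) j ≡ lookup (flipAt a z) j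
  at j j≢α = lookup-flipAt′ (flipAt a z) j≢α
  β≡a : β ≡ a
  β≡a with β Fin.≟ a
  ... | yes β≡a = β≡a
  ... | no  β≢a = ⊥-elim (Bool.not-¬ refl (begin
    lookup z a                                 ≡⟨ sym (lookup-flipAt′ z a≢b) ⟩
    lookup (flipAt b z) a                      ≡⟨ sym (lookup-flipAt′ (flipAt b z) (β≢a ∘ sym)) ⟩
    lookup (flipAt β (flipAt b z)) a           ≡⟨ cong (λ v → lookup v a) (sym eq) ⟩
    lookup (flipAt α (flipAt a z)) a           ≡⟨ at a (α≢a ∘ sym) ⟩
    lookup (flipAt a z) a                      ≡⟨ lookup-flipAt a z ⟩
    not (lookup z a)                           ∎))
    where open ≡-Reasoning
  β≢a : β ≢ a
  β≢a refl = Bool.not-¬ refl (begin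
    lookup z b                                 ≡⟨ sym (lookup-flipAt′ z (a≢b ∘ sym)) ⟩
    lookup (flipAt a z) b                      ≡⟨ sym (at b (α≢b ∘ sym)) ⟩
    lookup (flipAt α (flipAt a z)) b           ≡⟨ cong (λ v → lookup v b) eq ⟩
    lookup (flipAt a (flipAt b z)) b           ≡⟨ lookup-flipAt′ (flipAt b z) (a≢b ∘ sym) ⟩
    lookup (flipAt b z) b                      ≡⟨ lookup-flipAt b z ⟩
    not (lookup z b)                           ∎)
    where open ≡-Reasoning

module Classification {n} (g : Aut n) where
  private
    t f : Q n → Q n
    t = Aut.to g
    f = Aut.from g
    t∘f : ∀ y → t (f y) ≡ y
    t∘f = Inverse.strictlyInverseˡ (Aut.perm g)
    f∘t : ∀ x → f (t x) ≡ x
    f∘t = Inverse.strictlyInverseʳ (Aut.perm g)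
    zeros : Q n
    zeros = replicate n false
    unit : Fin n → Q n
    unit i = flipAt i zeros
    c : Q n
    c = t zeros

    -- g followed by a translation, so that zeros is fixed
    h h⁻¹ : Q n → Q n
    h x = t x ⊕ c
    h⁻¹ y = f (y ⊕ c)

    h⁻¹∘h : ∀ x → h⁻¹ (h x) ≡ x
    h⁻¹∘h x = trans (cong f (⊕-cancelʳ (t x) c)) (f∘t x)

    h∘h⁻¹ : ∀ y → h (h⁻¹ y) ≡ y
    h∘h⁻¹ y = trans (cong (_⊕ c) (t∘f (y ⊕ c))) (⊕-cancelʳ y c)

    h-injective : ∀ {x y} → h x ≡ h y → x ≡ y
    h-injective {x} {y} eq = trans (sym (h⁻¹∘h x)) (trans (cong h⁻¹ eq) (h⁻¹∘h y))

    h-zeros : h zeros ≡ zeros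
    h-zeros = ⊕-self c

    h⁻¹-zeros : h⁻¹ zeros ≡ zeros
    h⁻¹-zeros = trans (cong h⁻¹ (sym h-zeros)) (h⁻¹∘h zeros)

    h-adjacent : ∀ x y → Adj x y → Adj (h x) (h y)
    h-adjacent x y x~y = trans (hamming-⊕ (t x) (t y) c) (proj₁ (Aut.preserves g x y) x~y)

    h⁻¹-adjacent : ∀ x y → Adj x y → Adj (h⁻¹ x) (h⁻¹ y)
    h⁻¹-adjacent x y x~y = proj₂ (Aut.preserves g (h⁻¹ x) (h⁻¹ y)) (begin
      hamming (t (h⁻¹ x)) (t (h⁻¹ y))          ≡⟨ sym (hamming-⊕ (t (h⁻¹ x)) _ c) ⟩
      hamming (h (h⁻¹ x)) (h (h⁻¹ y))          ≡⟨ cong₂ hamming (h∘h⁻¹ x) (h∘h⁻¹ y) ⟩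
      hamming x y                              ≡⟨ x~y ⟩
      1                                        ∎)
      where open ≡-Reasoning

    unit-image : (φ : Q n → Q n) → φ zeros ≡ zeros → (∀ x y → Adj x y → Adj (φ x) (φ y)) →
                 ∀ i → Σ (Fin n) λ j → φ (unit i) ≡ unit j
    unit-image φ φ-zeros φ-adjacent i = hamming≡1⇒flipAt zeros (φ (unit i))
      (subst (λ z → hamming z (φ (unit i)) ≡ 1) φ-zeros (φ-adjacent zeros (unit i) (hamming-flipAt i zeros)))

    σ σ⁻¹ : Fin n → Fin n
    σ   = proj₁ ∘ unit-image h h-zeros h-adjacent
    σ⁻¹ = proj₁ ∘ unit-image h⁻¹ h⁻¹-zeros h⁻¹-adjacent

    h-unit : ∀ i → h (unit i) ≡ unit (σ i)
    h-unit = proj₂ ∘ unit-image h h-zeros h-adjacent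

    h⁻¹-unit : ∀ i → h⁻¹ (unit i) ≡ unit (σ⁻¹ i)
    h⁻¹-unit = proj₂ ∘ unit-image h⁻¹ h⁻¹-zeros h⁻¹-adjacent

    unit-injective : ∀ {i j} → unit i ≡ unit j → i ≡ j
    unit-injective {i} {j} eq with i Fin.≟ j
    ... | yes i≡j = i≡j
    ... | no  i≢j = ⊥-elim (Bool.not-¬ refl (begin
      true                 ≡⟨ cong not (sym (lookup-replicate i false)) ⟩
      not (lookup zeros i) ≡⟨ sym (lookup-flipAt i zeros) ⟩
      lookup (unit i) i    ≡⟨ cong (λ v → lookup v i) eq ⟩
      lookup (unit j) i    ≡⟨ lookup-flipAt′ zeros i≢j ⟩
      lookup zeros i       ≡⟨ lookup-replicate i false ⟩
      false                ∎))
      where open ≡-Reasoning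

    σ⁻¹∘σ : ∀ i → σ⁻¹ (σ i) ≡ i
    σ⁻¹∘σ i = unit-injective (trans (sym (h⁻¹-unit (σ i))) (trans (cong h⁻¹ (sym (h-unit i))) (h⁻¹∘h (unit i))))

    σ∘σ⁻¹ : ∀ i → σ (σ⁻¹ i) ≡ i
    σ∘σ⁻¹ i = unit-injective (trans (sym (h-unit (σ⁻¹ i))) (trans (cong h (sym (h⁻¹-unit i))) (h∘h⁻¹ (unit i))))

    P : Q n → Q n
    P x = tabulate (λ j → lookup x (σ⁻¹ j))

    P-zeros : P zeros ≡ zeros
    P-zeros = lookup-ext λ j →
      trans (lookup∘tabulate _ j) (trans (lookup-replicate (σ⁻¹ j) false) (sym (lookup-replicate j false)))

    P-flipAt : ∀ i x → P (flipAt i x) ≡ flipAt (σ i) (P x)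
    P-flipAt i x = lookup-ext pointwise
      where
      open ≡-Reasoning
      σ⁻¹-to-σ : ∀ {j} → σ⁻¹ j ≡ i → j ≡ σ i
      σ⁻¹-to-σ {j} σ⁻¹j≡i = trans (sym (σ∘σ⁻¹ j)) (cong σ σ⁻¹j≡i)
      pointwise : ∀ j → lookup (P (flipAt i x)) j ≡ lookup (flipAt (σ i) (P x)) j
      pointwise j with j Fin.≟ σ i
      ... | yes refl = begin
        lookup (P (flipAt i x)) (σ i)       ≡⟨ lookup∘tabulate _ (σ i) ⟩
        lookup (flipAt i x) (σ⁻¹ (σ i))     ≡⟨ cong (lookup (flipAt i x)) (σ⁻¹∘σ i) ⟩
        lookup (flipAt i x) i               ≡⟨ lookup-flipAt i x ⟩
        not (lookup x i)                    ≡⟨ cong (not ∘ lookup x) (sym (σ⁻¹∘σ i)) ⟩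
        not (lookup x (σ⁻¹ (σ i)))          ≡⟨ cong not (sym (lookup∘tabulate _ (σ i))) ⟩
        not (lookup (P x) (σ i))            ≡⟨ sym (lookup-flipAt (σ i) (P x)) ⟩
        lookup (flipAt (σ i) (P x)) (σ i)   ∎
      ... | no j≢σi = begin
        lookup (P (flipAt i x)) j           ≡⟨ lookup∘tabulate _ j ⟩
        lookup (flipAt i x) (σ⁻¹ j)         ≡⟨ lookup-flipAt′ x (j≢σi ∘ σ⁻¹-to-σ) ⟩
        lookup x (σ⁻¹ j)                    ≡⟨ sym (lookup∘tabulate _ j) ⟩
        lookup (P x) j                      ≡⟨ sym (lookup-flipAt′ (P x) j≢σi) ⟩
        lookup (flipAt (σ i) (P x)) j       ∎

    -- h x is a neighbour of h (flipAt i x), so agreement with P there pins h x down up to one flip.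
    via-neighbour : ∀ i x → h (flipAt i x) ≡ P (flipAt i x) → Σ (Fin n) λ α → h x ≡ flipAt α (flipAt (σ i) (P x))
    via-neighbour i x agrees with hamming≡1⇒flipAt (h x) (h (flipAt i x)) (h-adjacent x _ (hamming-flipAt i x))
    ... | α , hx′≡ = α , (begin
      h x                                     ≡⟨ sym (flipAt-involutive α (h x)) ⟩
      flipAt α (flipAt α (h x))               ≡⟨ cong (flipAt α) (sym hx′≡) ⟩
      flipAt α (h (flipAt i x))               ≡⟨ cong (flipAt α) agrees ⟩
      flipAt α (P (flipAt i x))               ≡⟨ cong (flipAt α) (P-flipAt i x) ⟩
      flipAt α (flipAt (σ i) (P x))           ∎)
      where open ≡-Reasoning

    h≡P-at-unit : ∀ p → h (unit p) ≡ P (unit p)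
    h≡P-at-unit p = begin
      h (unit p)                ≡⟨ h-unit p ⟩
      flipAt (σ p) zeros        ≡⟨ cong (flipAt (σ p)) (sym P-zeros) ⟩
      flipAt (σ p) (P zeros)    ≡⟨ sym (P-flipAt p zeros) ⟩
      P (unit p)                ∎
      where open ≡-Reasoning

    -- Both neighbours give a candidate for h x; they are common neighbours of flipAt (σ p) (P x)
    -- and flipAt (σ q) (P x), and the wrong one would make h x = h (flipAt q (flipAt p x)).
    h≡P-from-below : ∀ x p q → q ≢ p → lookup x p ≡ true →
      h (flipAt p x) ≡ P (flipAt p x) → h (flipAt q x) ≡ P (flipAt q x) →
      h (flipAt q (flipAt p x)) ≡ P (flipAt q (flipAt p x)) → h x ≡ P x
    h≡P-from-below x p q q≢p xₚ agree-p agree-q agree-pq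
      with via-neighbour p x agree-p | via-neighbour q x agree-q
    ... | α , hx≡α | β , hx≡β with common-neighbour α β (σ p) (σ q) (P x) σp≢σq (trans (sym hx≡α) hx≡β)
      where
      σp≢σq : σ p ≢ σ q
      σp≢σq σp≡σq = q≢p (sym (trans (sym (σ⁻¹∘σ p)) (trans (cong σ⁻¹ σp≡σq) (σ⁻¹∘σ q))))
    ... | inj₁ refl = trans hx≡α (flipAt-involutive (σ p) (P x))
    ... | inj₂ refl = ⊥-elim (Bool.not-¬ refl (begin
      true                                 ≡⟨ sym xₚ ⟩
      lookup x p                           ≡⟨ cong (λ v → lookup v p) x≡ ⟩
      lookup (flipAt q (flipAt p x)) p     ≡⟨ lookup-flipAt′ (flipAt p x) (q≢p ∘ sym) ⟩
      lookup (flipAt p x) p                ≡⟨ lookup-flipAt p x ⟩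
      not (lookup x p)                     ≡⟨ cong not xₚ ⟩
      false                                ∎))
      where
      open ≡-Reasoning
      x≡ : x ≡ flipAt q (flipAt p x)
      x≡ = h-injective (begin
        h x                                 ≡⟨ hx≡α ⟩
        flipAt (σ q) (flipAt (σ p) (P x))   ≡⟨ cong (flipAt (σ q)) (sym (P-flipAt p x)) ⟩
        flipAt (σ q) (P (flipAt p x))       ≡⟨ sym (P-flipAt q (flipAt p x)) ⟩
        P (flipAt q (flipAt p x))           ≡⟨ sym agree-pq ⟩
        h (flipAt q (flipAt p x))           ∎)

    h≡P-by-weight : ∀ k → (∀ {k′} → k′ < k → ∀ x → weight x ≡ k′ → h x ≡ P x) →
                    ∀ x → weight x ≡ k → h x ≡ P x
    h≡P-by-weight zero _ x wx≡0 = begin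
      h x         ≡⟨ cong h (weight≡0⇒zeros x wx≡0) ⟩
      h zeros     ≡⟨ h-zeros ⟩
      zeros       ≡⟨ sym P-zeros ⟩
      P zeros     ≡⟨ cong P (sym (weight≡0⇒zeros x wx≡0)) ⟩
      P x         ∎
      where open ≡-Reasoning
    h≡P-by-weight (suc w) IH x wx with weight≢0⇒one x wx
    ... | p , xₚ with weight (flipAt p x) in wx₁
    ...   | zero = subst (λ v → h v ≡ P v) x≡unit (h≡P-at-unit p)
      where
      x≡unit : unit p ≡ x
      x≡unit = trans (cong (flipAt p) (sym (weight≡0⇒zeros (flipAt p x) wx₁))) (flipAt-involutive p x)
    ...   | suc w′ with weight≢0⇒one (flipAt p x) wx₁
    ...     | q , x₁q = h≡P-from-below x p q q≢p xₚ
      (IH w<1+w (flipAt p x) (suc-injective w≡))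
      (IH w<1+w (flipAt q x) (suc-injective (trans (weight-flipAt x q xq) wx)))
      (IH w′<1+w (flipAt q (flipAt p x)) (suc-injective (trans (weight-flipAt (flipAt p x) q x₁q) wx₁)))
      where
      w≡ : suc (weight (flipAt p x)) ≡ suc w
      w≡ = trans (weight-flipAt x p xₚ) wx
      w<1+w : w < suc w
      w<1+w = ≤-refl
      w′<1+w : w′ < suc w
      w′<1+w = s≤s (≤-trans (n≤1+n w′) (≤-reflexive (trans (sym wx₁) (suc-injective w≡))))
      q≢p : q ≢ p
      q≢p refl = Bool.not-¬ refl (trans (sym x₁q) (trans (lookup-flipAt p x) (cong not xₚ)))
      xq : lookup x q ≡ true
      xq = trans (sym (lookup-flipAt′ x q≢p)) x₁q

    h≡P : ∀ x → h x ≡ P x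
    h≡P x = <-rec (λ k → ∀ x → weight x ≡ k → h x ≡ P x) h≡P-by-weight (weight x) x refl

  symmetry : CubeSym n
  symmetry = cubeSym (Perm.permutation σ⁻¹ σ σ⁻¹∘σ σ∘σ⁻¹) c

  to≡act : ∀ x → t x ≡ act symmetry x
  to≡act x = lookup-ext λ i → begin
    lookup (t x) i                      ≡⟨ cong (λ v → lookup v i) (sym (⊕-cancelʳ (t x) c)) ⟩
    lookup (h x ⊕ c) i                  ≡⟨ cong (λ v → lookup (v ⊕ c) i) (h≡P x) ⟩
    lookup (P x ⊕ c) i                  ≡⟨ Vec.lookup-zipWith _xor_ i (P x) c ⟩
    lookup (P x) i xor lookup c i       ≡⟨ cong (_xor lookup c i) (lookup∘tabulate _ i) ⟩
    lookup x (σ⁻¹ i) xor lookup c i     ≡⟨ sym (lookup-act symmetry x i) ⟩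
    lookup (act symmetry x) i           ∎
    where open ≡-Reasoning

  from≡act-inv : ∀ y → f y ≡ act (inv symmetry) y
  from≡act-inv y = sym (act-inv-unique symmetry (trans (sym (to≡act (f y))) (t∘f y)))

automorphism-image : ∀ {n} (g : Aut n) → Σ (CubeSym n) λ E → ∀ S → image g S ≐ img E S
automorphism-image g = symmetry , λ S y → cong S (from≡act-inv y)
  where open Classification g

∣image-I∣ : ∀ {n} (g : Aut n) k → k ≤ 2 ^ n → ∣ image g (I k) ∣ ≡ k
∣image-I∣ {n} g k k≤2^n =
  trans (∣∣-cong (proj₂ (automorphism-image g) (I k))) (∣seg∣ {n} (proj₁ (automorphism-image g)) k k≤2^n)

-- Three segment images balancing every coordinate

Partition : ∀ {n} → Subset n → Subset n → Subset n → Set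
Partition X Y W = ∀ v → ind (X v) + ind (Y v) + ind (W v) ≡ 1

Balanced : ∀ {n} → Subset n → Subset n → Subset n → Set
Balanced {n} X Y W = ∀ i → 2 * (M X i + M Y i + M W i) ≡ 2 ^ n

Partition-rotate : ∀ {n} {X Y W : Subset n} → Partition X Y W → Partition Y W X
Partition-rotate {X = X} {Y} {W} part v = trans (xy∙z≈zx∙y (ind (Y v)) (ind (W v)) (ind (X v))) (part v)

Partition-swap₂₃ : ∀ {n} {X Y W : Subset n} → Partition X Y W → Partition X W Y
Partition-swap₂₃ {X = X} {Y} {W} part v = trans (xy∙z≈xz∙y (ind (X v)) (ind (W v)) (ind (Y v))) (part v)

Balanced-rotate : ∀ {n} {X Y W : Subset n} → Balanced X Y W → Balanced Y W X
Balanced-rotate {X = X} {Y} {W} bal i = trans (cong (2 *_) (xy∙z≈zx∙y (M Y i) (M W i) (M X i))) (bal i)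

Balanced-swap₂₃ : ∀ {n} {X Y W : Subset n} → Balanced X Y W → Balanced X W Y
Balanced-swap₂₃ {X = X} {Y} {W} bal i = trans (cong (2 *_) (xy∙z≈xz∙y (M X i) (M W i) (M Y i))) (bal i)

module Rotations {n} {X Y W : Subset n} {x y r N} (sizes : x + y + r ≡ N) (bal : Balanced X Y W) where

  sizes-Y : y + r + x ≡ N
  sizes-Y = trans (xy∙z≈zx∙y y r x) sizes

  sizes-W : r + x + y ≡ N
  sizes-W = trans (xy∙z≈zx∙y r x y) sizes-Y

  bal-Y : Balanced Y W X
  bal-Y = Balanced-rotate {X = X} {Y} {W} bal

  bal-W : Balanced W X Y
  bal-W = Balanced-rotate {X = Y} {W} {X} bal-Y

  from-Y : Partition Y W X → Partition X Y W
  from-Y = Partition-rotate {X = W} {X} {Y} ∘ Partition-rotate {X = Y} {W} {X}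

  from-W : Partition W X Y → Partition X Y W
  from-W = Partition-rotate {X = W} {X} {Y}

summands-≤ : ∀ {x y r N} → x + y + r ≡ N → x ≤ N × y ≤ N × r ≤ N
summands-≤ {x} {y} {r} refl =
  ≤-trans (m≤m+n x y) (m≤m+n (x + y) r) , ≤-trans (m≤n+m y x) (m≤m+n (x + y) r) , m≤n+m r (x + y)

-- X ∪ Y has the size and the column sums of ∁ W, itself a segment image, and segment images
-- are determined by these.
disjoint-pair-partition : ∀ {n} (X Y : Subset n) (E : CubeSym n) r → ∣ X ∣ + ∣ Y ∣ + r ≡ 2 ^ n →
  Balanced X Y (seg E r) → Disjoint X Y → Partition X Y (seg E r)
disjoint-pair-partition {n} X Y E r sizes bal X∩Y≡∅ v = begin
  ind (X v) + ind (Y v) + ind (W v)   ≡⟨ cong (_+ ind (W v)) (sym (ind-∨ (X v) (Y v) (X∩Y≡∅ v))) ⟩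
  ind (U v) + ind (W v)               ≡⟨ cong (λ b → ind b + ind (W v)) (U≐∁W v) ⟩
  ind (not (W v)) + ind (W v)         ≡⟨ ind-not (W v) ⟩
  1                                   ∎
  where
  open ≡-Reasoning
  W = seg E r
  U = X ∪ Y
  k = ∣ X ∣ + ∣ Y ∣
  k≤2^n : k ≤ 2 ^ n
  k≤2^n = ≤-trans (m≤m+n k r) (≤-reflexive sizes)
  ind-not : ∀ b → ind (not b) + ind b ≡ 1
  ind-not false = refl
  ind-not true  = refl
  Z≐∁W : seg (complement E) k ≐ ∁ W
  Z≐∁W = seg-complement E k r sizes
  M-U : ∀ i → M U i ≡ M (seg (complement E) k) i
  M-U i = +-cancelʳ-≡ (M W i) _ _ (begin
    M U i + M W i                            ≡⟨ cong (_+ M W i) (M-∪ X∩Y≡∅ i) ⟩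
    M X i + M Y i + M W i                    ≡⟨ *-cancelˡ-≡ _ _ 2 (trans (bal i) (sym (2*M-full i))) ⟩
    M full i                                 ≡⟨ sym (M-∁ W i) ⟩
    M (∁ W) i + M W i                        ≡⟨ cong (_+ M W i) (sym (M-cong Z≐∁W i)) ⟩
    M (seg (complement E) k) i + M W i       ∎)
  U≐∁W : U ≐ ∁ W
  U≐∁W y = trans (segment-image-unique (complement E) U k k≤2^n (∣∪∣ X∩Y≡∅) M-U y) (Z≐∁W y)

Core : ℕ → Set
Core n = ∀ (EX EY EW : CubeSym n) x y r → x + y + r ≡ 2 ^ n →
  Balanced (seg EX x) (seg EY y) (seg EW r) → Partition (seg EX x) (seg EY y) (seg EW r)

face-sizes : ∀ {m} (X Y W : Subset (suc m)) → ∣ X ∣ + ∣ Y ∣ + ∣ W ∣ ≡ 2 ^ suc m →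
  2 * (M X zero + M Y zero + M W zero) ≡ 2 ^ suc m →
  ∀ b → ∣ X ∘ (b ∷_) ∣ + ∣ Y ∘ (b ∷_) ∣ + ∣ W ∘ (b ∷_) ∣ ≡ 2 ^ m
face-sizes {m} X Y W sizes bal₀ true = *-cancelˡ-≡ _ _ 2 (begin
  2 * (∣ X ∘ (true ∷_) ∣ + ∣ Y ∘ (true ∷_) ∣ + ∣ W ∘ (true ∷_) ∣)
    ≡⟨ cong (2 *_) (sym (cong₂ _+_ (cong₂ _+_ (M-head X) (M-head Y)) (M-head W))) ⟩
  2 * (M X zero + M Y zero + M W zero)  ≡⟨ bal₀ ⟩
  2 * 2 ^ m                             ∎)
  where open ≡-Reasoning
face-sizes {m} X Y W sizes bal₀ false = +-cancelʳ-≡ (2 ^ m) _ _ (begin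
  (x₀ + y₀ + w₀) + 2 ^ m                ≡⟨ cong ((x₀ + y₀ + w₀) +_) (sym (face-sizes X Y W sizes bal₀ true)) ⟩
  (x₀ + y₀ + w₀) + (x₁ + y₁ + w₁)       ≡⟨ regroup x₀ y₀ w₀ x₁ y₁ w₁ ⟩
  (x₀ + x₁) + (y₀ + y₁) + (w₀ + w₁)     ≡⟨ sizes ⟩
  2 ^ m + (2 ^ m + 0)                   ≡⟨ cong (2 ^ m +_) (+-identityʳ (2 ^ m)) ⟩
  2 ^ m + 2 ^ m                         ∎)
  where
  open ≡-Reasoning
  x₀ = ∣ X ∘ (false ∷_) ∣
  y₀ = ∣ Y ∘ (false ∷_) ∣
  w₀ = ∣ W ∘ (false ∷_) ∣
  x₁ = ∣ X ∘ (true ∷_) ∣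
  y₁ = ∣ Y ∘ (true ∷_) ∣
  w₁ = ∣ W ∘ (true ∷_) ∣
  regroup : ∀ a b c d e f → (a + b + c) + (d + e + f) ≡ (a + d) + (b + e) + (c + f)
  regroup = solve 6 (λ a b c d e f → (a :+ b :+ c) :+ (d :+ e :+ f) := (a :+ d) :+ (b :+ e) :+ (c :+ f)) refl

-- X contains the face v₀ = c₀; balance at coordinate 0 then leaves no room there for Y and W, and
-- on the opposite face all three are segment images again, so the induction hypothesis applies.
module HeadFixed {m} (IH : Core m) (EX EY EW : CubeSym (suc m)) (x y r : ℕ) (sizes : x + y + r ≡ 2 ^ suc m)
  (bal : Balanced (seg EX x) (seg EY y) (seg EW r)) (π0≡0 : perm EX ⟨$⟩ʳ zero ≡ zero) (H≤x : 2 ^ m ≤ x) where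

  private
    H = 2 ^ m
    X = seg EX x
    Y = seg EY y
    W = seg EW r
    c₀ = lookup (flips EX) zero
    x′ = x ∸ H
    X′ = seg (restrict EX) x′

    X-c₀ : ∀ y′ → X (c₀ ∷ y′) ≡ true
    X-c₀ y′ = trans (img-∷ EX π0≡0 (I x) c₀ y′)
                    (trans (cong (λ b → I x (b ∷ z)) (Bool.xor-same c₀)) (I-full {m} x H≤x z))
      where z = act (inv (restrict EX)) y′

    X-¬c₀ : ∀ y′ → X (not c₀ ∷ y′) ≡ X′ y′
    X-¬c₀ y′ = trans (img-∷ EX π0≡0 (I x) (not c₀) y′)
                     (trans (cong (λ b → I x (b ∷ z)) (Bool.xor-inverseˡ c₀)) (I-upper {m} x z))
      where z = act (inv (restrict EX)) y′

    x≤ : x ≤ 2 ^ suc m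
    x≤ = proj₁ (summands-≤ {x} {y} {r} sizes)
    y≤ : y ≤ 2 ^ suc m
    y≤ = proj₁ (proj₂ (summands-≤ {x} {y} {r} sizes))
    r≤ : r ≤ 2 ^ suc m
    r≤ = proj₂ (proj₂ (summands-≤ {x} {y} {r} sizes))

    sizes′ : x′ + y + r ≡ H
    sizes′ = +-cancelˡ-≡ H _ _ (begin
      H + (x′ + y + r)     ≡⟨ solve 4 (λ h a b c → h :+ (a :+ b :+ c) := h :+ a :+ b :+ c) refl H x′ y r ⟩
      H + x′ + y + r       ≡⟨ cong (λ t → t + y + r) (m+[n∸m]≡n H≤x) ⟩
      x + y + r            ≡⟨ sizes ⟩
      H + (H + 0)          ≡⟨ cong (H +_) (+-identityʳ H) ⟩
      H + H                ∎)
      where open ≡-Reasoning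

    y≤H : y ≤ H
    y≤H = proj₁ (proj₂ (summands-≤ {x′} {y} {r} sizes′))
    r≤H : r ≤ H
    r≤H = proj₂ (proj₂ (summands-≤ {x′} {y} {r} sizes′))

    c₀-face-sizes : ∣ Y ∘ (c₀ ∷_) ∣ + ∣ W ∘ (c₀ ∷_) ∣ ≡ 0
    c₀-face-sizes = +-cancelˡ-≡ H _ 0 (begin
      H + (∣ Y ∘ (c₀ ∷_) ∣ + ∣ W ∘ (c₀ ∷_) ∣)
        ≡⟨ sym (+-assoc H _ _) ⟩
      H + ∣ Y ∘ (c₀ ∷_) ∣ + ∣ W ∘ (c₀ ∷_) ∣
        ≡⟨ cong (λ t → t + ∣ Y ∘ (c₀ ∷_) ∣ + ∣ W ∘ (c₀ ∷_) ∣) (sym ∣X-c₀∣) ⟩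
      ∣ X ∘ (c₀ ∷_) ∣ + ∣ Y ∘ (c₀ ∷_) ∣ + ∣ W ∘ (c₀ ∷_) ∣
        ≡⟨ face-sizes X Y W (trans (cong₂ _+_ (cong₂ _+_ (∣seg∣ EX x x≤) (∣seg∣ EY y y≤)) (∣seg∣ EW r r≤)) sizes)
                      (bal zero) c₀ ⟩
      H ≡⟨ sym (+-identityʳ H) ⟩
      H + 0 ∎)
      where
      open ≡-Reasoning
      ∣X-c₀∣ : ∣ X ∘ (c₀ ∷_) ∣ ≡ H
      ∣X-c₀∣ = trans (∣∣-cong X-c₀) (trans (∑-const m 1) (*-identityˡ H))

    Y-c₀ : ∀ y′ → Y (c₀ ∷ y′) ≡ false
    Y-c₀ = ∣∣≡0⇒empty (Y ∘ (c₀ ∷_)) (m+n≡0⇒m≡0 _ c₀-face-sizes)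

    W-c₀ : ∀ y′ → W (c₀ ∷ y′) ≡ false
    W-c₀ = ∣∣≡0⇒empty (W ∘ (c₀ ∷_)) (m+n≡0⇒n≡0 _ c₀-face-sizes)

    Y-restriction : Σ (CubeSym m) λ E′ → ∀ y′ → Y (not c₀ ∷ y′) ≡ seg E′ y y′
    Y-restriction = face-restriction EY y (not c₀) y≤H (empty-face⇒⊆opposite Y c₀ Y-c₀)

    W-restriction : Σ (CubeSym m) λ E′ → ∀ y′ → W (not c₀ ∷ y′) ≡ seg E′ r y′
    W-restriction = face-restriction EW r (not c₀) r≤H (empty-face⇒⊆opposite W c₀ W-c₀)

    Y′ = seg (proj₁ Y-restriction) y
    W′ = seg (proj₁ W-restriction) r

    Y-¬c₀ : ∀ y′ → Y (not c₀ ∷ y′) ≡ Y′ y′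
    Y-¬c₀ = proj₂ Y-restriction

    W-¬c₀ : ∀ y′ → W (not c₀ ∷ y′) ≡ W′ y′
    W-¬c₀ = proj₂ W-restriction

    M-empty : ∀ {S : Subset m} → (∀ y′ → S y′ ≡ false) → ∀ i → M S i ≡ 0
    M-empty S≐∅ i = trans (M-cong S≐∅ i) (∑-zero m)

    bal′ : Balanced X′ Y′ W′
    bal′ i = +-cancelˡ-≡ H _ _ (begin
      H + 2 * (M X′ i + M Y′ i + M W′ i)
        ≡⟨ cong (_+ 2 * (M X′ i + M Y′ i + M W′ i)) (sym (2*M-full i)) ⟩
      2 * M full i + 2 * (M X′ i + M Y′ i + M W′ i)
        ≡⟨ solve 4 (λ f a b c → con 2 :* f :+ con 2 :* (a :+ b :+ c) := con 2 :* ((f :+ a) :+ (con 0 :+ b) :+ (con 0 :+ c))) refl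
                 (M full i) (M X′ i) (M Y′ i) (M W′ i) ⟩
      2 * ((M full i + M X′ i) + (0 + M Y′ i) + (0 + M W′ i))
        ≡⟨ cong (2 *_) (sym (cong₂ _+_ (cong₂ _+_ M-X M-Y) M-W)) ⟩
      2 * (M X (suc i) + M Y (suc i) + M W (suc i))
        ≡⟨ bal (suc i) ⟩
      H + (H + 0)
        ≡⟨ cong (H +_) (+-identityʳ H) ⟩
      H + H ∎)
      where
      open ≡-Reasoning
      M-X : M X (suc i) ≡ M full i + M X′ i
      M-X = trans (M-suc-split X c₀ i) (cong₂ _+_ (M-cong X-c₀ i) (M-cong X-¬c₀ i))
      M-Y : M Y (suc i) ≡ 0 + M Y′ i
      M-Y = trans (M-suc-split Y c₀ i) (cong₂ _+_ (M-empty Y-c₀ i) (M-cong Y-¬c₀ i))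
      M-W : M W (suc i) ≡ 0 + M W′ i
      M-W = trans (M-suc-split W c₀ i) (cong₂ _+_ (M-empty W-c₀ i) (M-cong W-¬c₀ i))

  partition : Partition X Y W
  partition (b ∷ y′) with bool-cases b c₀
  ... | inj₁ refl = cong₂ _+_ (cong₂ _+_ (cong ind (X-c₀ y′)) (cong ind (Y-c₀ y′))) (cong ind (W-c₀ y′))
  ... | inj₂ refl = trans (cong₂ _+_ (cong₂ _+_ (cong ind (X-¬c₀ y′)) (cong ind (Y-¬c₀ y′))) (cong ind (W-¬c₀ y′)))
                          (IH (restrict EX) (proj₁ Y-restriction) (proj₁ W-restriction) x′ y r sizes′ bal′ y′)

-- Conjugating by a coordinate permutation moves the coordinate orthogonal to X's big face to 0.
big-set-partition : ∀ {m} → Core m → ∀ (EX EY EW : CubeSym (suc m)) x y r → x + y + r ≡ 2 ^ suc m →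
  Balanced (seg EX x) (seg EY y) (seg EW r) → 2 ^ m ≤ x → Partition (seg EX x) (seg EY y) (seg EW r)
big-set-partition IH EX EY EW x y r sizes bal H≤x v = begin
  ind (seg EX x v) + ind (seg EY y v) + ind (seg EW r v)
    ≡⟨ sym (cong₂ _+_ (cong₂ _+_ (cong ind (back EX x)) (cong ind (back EY y))) (cong ind (back EW r))) ⟩
  ind (seg (Γ ⊙ EX) x (act Γ v)) + ind (seg (Γ ⊙ EY) y (act Γ v)) + ind (seg (Γ ⊙ EW) r (act Γ v))
    ≡⟨ HeadFixed.partition IH (Γ ⊙ EX) (Γ ⊙ EY) (Γ ⊙ EW) x y r sizes bal′ (inverseʳ (perm EX)) H≤x (act Γ v) ⟩
  1 ∎
  where
  open ≡-Reasoning
  τ = Perm.flip (perm EX)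
  Γ = permute τ
  back : ∀ E s → seg (Γ ⊙ E) s (act Γ v) ≡ seg E s v
  back E s = img-⊙-act Γ E (I s) v
  bal′ : Balanced (seg (Γ ⊙ EX) x) (seg (Γ ⊙ EY) y) (seg (Γ ⊙ EW) r)
  bal′ i = trans (cong (2 *_) (cong₂ _+_ (cong₂ _+_ (M-img-permute-⊙ τ EX (I x) i) (M-img-permute-⊙ τ EY (I y) i))
                                          (M-img-permute-⊙ τ EW (I r) i)))
                 (bal (τ ⟨$⟩ʳ i))

imbalance : ∀ {n} → Subset n → ℕ → Fin n → ℕ
imbalance S s i = ∣ 2 * M S i - s ∣

imbalance-triangle : ∀ {A B C s t u} → A + B + C ≡ s + t + u → ∣ A - s ∣ ≤ ∣ B - t ∣ + ∣ C - u ∣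
imbalance-triangle {A} {B} {C} {s} {t} {u} eq = begin
  ∣ A - s ∣                                ≡⟨ sym (∣m+n-m+o∣≡∣n-o∣ (B + C) A s) ⟩
  ∣ (B + C) + A - (B + C) + s ∣            ≡⟨ cong₂ ∣_-_∣ (trans (+-comm (B + C) A) regroup) (+-comm (B + C) s) ⟩
  ∣ s + (t + u) - s + (B + C) ∣            ≡⟨ ∣m+n-m+o∣≡∣n-o∣ s (t + u) (B + C) ⟩
  ∣ t + u - B + C ∣                        ≤⟨ ∣-∣-triangle (t + u) (B + u) (B + C) ⟩
  ∣ t + u - B + u ∣ + ∣ B + u - B + C ∣
    ≡⟨ cong₂ _+_ (trans (cong₂ ∣_-_∣ (+-comm t u) (+-comm B u)) (∣m+n-m+o∣≡∣n-o∣ u t B))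
                 (∣m+n-m+o∣≡∣n-o∣ B u C) ⟩
  ∣ t - B ∣ + ∣ u - C ∣                    ≡⟨ cong₂ _+_ (∣-∣-comm t B) (∣-∣-comm u C) ⟩
  ∣ B - t ∣ + ∣ C - u ∣                    ∎
  where
  open ≤-Reasoning
  regroup : A + (B + C) ≡ s + (t + u)
  regroup = trans (sym (+-assoc A B C)) (trans eq (+-assoc s t u))

imbalance-seg : ∀ {n} (E : CubeSym n) s i → s ≤ 2 ^ n → imbalance (seg E s) s i ≡ s ∸ 2 * μ (perm E ⟨$⟩ʳ i) s
imbalance-seg {n} E s i s≤2^n with lookup (flips E) i in cᵢ
... | false = trans (cong (λ a → ∣ 2 * a - s ∣) (M-img-unflipped E (I s) i cᵢ)) (m≤n⇒∣m-n∣≡n∸m (2*μ≤k u s s≤2^n))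
  where u = perm E ⟨$⟩ʳ i
... | true  = begin
  ∣ 2 * M (seg E s) i - s ∣          ≡⟨ cong₂ ∣_-_∣ 2M≡s+β (sym (+-identityʳ s)) ⟩
  ∣ s + β - s + 0 ∣                  ≡⟨ ∣m+n-m+o∣≡∣n-o∣ s β 0 ⟩
  ∣ β - 0 ∣                          ≡⟨ ∣-∣-identityʳ β ⟩
  β                                  ∎
  where
  open ≡-Reasoning
  u = perm E ⟨$⟩ʳ i
  β = s ∸ 2 * μ u s
  M+μ≡s : M (seg E s) i + μ u s ≡ s
  M+μ≡s = trans (M-img-flipped E (I s) i cᵢ) (∣I∣ n s s≤2^n)
  2M≡s+β : 2 * M (seg E s) i ≡ s + β
  2M≡s+β = +-cancelʳ-≡ (2 * μ u s) _ _ (begin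
    2 * M (seg E s) i + 2 * μ u s    ≡⟨ sym (*-distribˡ-+ 2 (M (seg E s) i) (μ u s)) ⟩
    2 * (M (seg E s) i + μ u s)      ≡⟨ cong (2 *_) M+μ≡s ⟩
    s + (s + 0)                      ≡⟨ cong (s +_) (trans (+-identityʳ s) (sym (m∸n+n≡m (2*μ≤k u s s≤2^n)))) ⟩
    s + (β + 2 * μ u s)              ≡⟨ sym (+-assoc s β _) ⟩
    s + β + 2 * μ u s                ∎)

Facet : ∀ {n} → Subset n → ℕ → Fin n → Set
Facet S s i = M S i ≡ 0 ⊎ M S i ≡ s

facet-seg : ∀ {n} (E : CubeSym n) s i → s ≤ 2 ^ n → μ (perm E ⟨$⟩ʳ i) s ≡ 0 → Facet (seg E s) s i
facet-seg {n} E s i s≤2^n μ≡0 with lookup (flips E) i in cᵢ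
... | false = inj₁ (trans (M-img-unflipped E (I s) i cᵢ) μ≡0)
... | true  = inj₂ (begin
  M (seg E s) i                              ≡⟨ sym (+-identityʳ _) ⟩
  M (seg E s) i + 0                          ≡⟨ cong (M (seg E s) i +_) (sym μ≡0) ⟩
  M (seg E s) i + μ (perm E ⟨$⟩ʳ i) s        ≡⟨ M-img-flipped E (I s) i cᵢ ⟩
  ∣ I {n} s ∣                                ≡⟨ ∣I∣ n s s≤2^n ⟩
  s                                          ∎)
  where open ≡-Reasoning

-- A and B cannot lie on the same side of coordinate i: C alone is too small to fill the other
-- side, and A and B together overfill it.
facet-pair-disjoint : ∀ {n} {A B C : Subset n} {a b c H} i → ∣ A ∣ ≡ a → ∣ B ∣ ≡ b → ∣ C ∣ ≡ c →
  a + b + c ≡ 2 * H → c < H → M A i + M B i + M C i ≡ H → Facet A a i → Facet B b i → Disjoint A B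
facet-pair-disjoint {A = A} {B} {C} {a} {b} {c} {H} i ∣A∣ ∣B∣ ∣C∣ sizes c<H bal = cases
  where
  open ≤-Reasoning
  H<a+b : H < a + b
  H<a+b = +-cancelʳ-< H H (a + b) (begin-strict
    H + H           ≡⟨ cong (H +_) (sym (+-identityʳ H)) ⟩
    2 * H           ≡⟨ sym sizes ⟩
    a + b + c       <⟨ +-monoʳ-< (a + b) c<H ⟩
    a + b + H       ∎)
  cases : Facet A a i → Facet B b i → Disjoint A B
  cases (inj₁ MA≡0) (inj₁ MB≡0) = ⊥-elim (<⇒≱ c<H (begin
    H                        ≡⟨ sym bal ⟩
    M A i + M B i + M C i    ≡⟨ cong₂ (λ p q → p + q + M C i) MA≡0 MB≡0 ⟩
    M C i                    ≤⟨ M≤∣∣ C i ⟩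
    ∣ C ∣                    ≡⟨ ∣C∣ ⟩
    c                        ∎))
  cases (inj₂ MA≡a) (inj₂ MB≡b) = ⊥-elim (<⇒≱ H<a+b (begin
    a + b                    ≤⟨ m≤m+n (a + b) (M C i) ⟩
    a + b + M C i            ≡⟨ cong₂ (λ p q → p + q + M C i) (sym MA≡a) (sym MB≡b) ⟩
    M A i + M B i + M C i    ≡⟨ bal ⟩
    H                        ∎))
  cases (inj₁ MA≡0) (inj₂ MB≡b) =
    opposite-faces-disjoint i (M≡0⇒⊆face A i MA≡0) (M≡∣∣⇒⊆face B i (trans MB≡b (sym ∣B∣)))
  cases (inj₂ MA≡a) (inj₁ MB≡0) = Disjoint-sym {A = B} {A}
    (opposite-faces-disjoint i (M≡0⇒⊆face B i MB≡0) (M≡∣∣⇒⊆face A i (trans MA≡a (sym ∣A∣))))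

record Gap {m} (E : CubeSym (suc m)) (s : ℕ) (i : Fin (suc m)) : Set where
  field
    off-top   : perm E ⟨$⟩ʳ i ≢ zero
    gap≤place : imbalance (seg E s) s i ≤ place (perm E ⟨$⟩ʳ i)
    place<s   : place (perm E ⟨$⟩ʳ i) < s
    gap+s≤H   : imbalance (seg E s) s i + s ≤ 2 ^ m

facet-or-gap : ∀ {m} (E : CubeSym (suc m)) s i → s ≤ 2 ^ m → Facet (seg E s) s i ⊎ Gap E s i
facet-or-gap {m} E s i s≤H with μ (perm E ⟨$⟩ʳ i) s Data.Nat.≟ 0
... | yes μ≡0 = inj₁ (facet-seg E s i (≤-double s≤H) μ≡0)
... | no  μ≢0 = inj₂ (record
  { off-top   = u≢0
  ; gap≤place = subst (_≤ place u) (sym β≡) (m≤n+o⇒m∸n≤o s (2 * μ u s) (k≤2*μ+place u s (≤-double s≤H)))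
  ; place<s   = ≰⇒> (μ≢0 ∘ k≤place⇒μ≡0 u s)
  ; gap+s≤H   = subst (λ β → β + s ≤ 2 ^ m) (sym β≡) (k∸2*μ+k≤2^n u s u≢0 s≤H)
  })
  where
  u = perm E ⟨$⟩ʳ i
  u≢0 : u ≢ zero
  u≢0 u≡0 = μ≢0 (trans (cong (λ j → μ j s) u≡0) (μ-zero-lower {m} s s≤H))
  β≡ : imbalance (seg E s) s i ≡ s ∸ 2 * μ u s
  β≡ = imbalance-seg E s i (≤-double s≤H)

gap-off-top : ∀ {m} {E : CubeSym (suc m)} {s i} → Gap E s i → i ≢ perm E ⟨$⟩ˡ zero
gap-off-top {E = E} g refl = Gap.off-top g (inverseʳ (perm E))

bound-from-triangle : ∀ {H t s s′ β β′} → t + s + s′ ≡ 2 * H → t ≤ β + β′ → β′ + s′ ≤ H → H ≤ β + s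
bound-from-triangle {H} {t} {s} {s′} {β} {β′} sizes t≤ β′+s′≤H = +-cancelʳ-≤ H H (β + s) (begin
  H + H                  ≡⟨ cong (H +_) (sym (+-identityʳ H)) ⟩
  2 * H                  ≡⟨ sym sizes ⟩
  t + s + s′             ≤⟨ +-monoˡ-≤ s′ (+-monoˡ-≤ s t≤) ⟩
  β + β′ + s + s′        ≡⟨ solve 4 (λ b b′ s s′ → b :+ b′ :+ s :+ s′ := b :+ s :+ (b′ :+ s′)) refl β β′ s s′ ⟩
  β + s + (β′ + s′)      ≤⟨ +-monoʳ-≤ (β + s) β′+s′≤H ⟩
  β + s + H              ∎)
  where open ≤-Reasoning

below-two-thirds : ∀ {H s β p p′} → β ≤ p → 2 * p ≤ p′ → p′ < s → H ≤ β + s → 2 * H < 3 * s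
below-two-thirds {H} {s} {β} {p} {p′} β≤p 2p≤p′ p′<s H≤β+s = begin-strict
  2 * H                  ≤⟨ *-monoʳ-≤ 2 (≤-trans H≤β+s (+-monoˡ-≤ s β≤p)) ⟩
  2 * (p + s)            ≡⟨ *-distribˡ-+ 2 p s ⟩
  2 * p + 2 * s          ≤⟨ +-monoˡ-≤ (2 * s) 2p≤p′ ⟩
  p′ + 2 * s             <⟨ +-monoˡ-< (2 * s) p′<s ⟩
  s + 2 * s              ≡⟨ solve 1 (λ s → s :+ con 2 :* s := con 3 :* s) refl s ⟩
  3 * s                  ∎
  where open ≤-Reasoning

two-gaps : ∀ {m} {E : CubeSym (suc m)} {s i j} → Gap E s i → Gap E s j → i ≢ j →
  2 ^ m ≤ imbalance (seg E s) s i + s → 2 ^ m ≤ imbalance (seg E s) s j + s → 2 * 2 ^ m < 3 * s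
two-gaps {E = E} gᵢ gⱼ i≢j Hᵢ Hⱼ with place-separated (i≢j ∘ permutation-injective (perm E))
... | inj₁ 2pᵢ≤pⱼ = below-two-thirds (Gap.gap≤place gᵢ) 2pᵢ≤pⱼ (Gap.place<s gⱼ) Hᵢ
... | inj₂ 2pⱼ≤pᵢ = below-two-thirds (Gap.gap≤place gⱼ) 2pⱼ≤pᵢ (Gap.place<s gᵢ) Hⱼ

no-three-thirds : ∀ {H x y r} → x + y + r ≡ 2 * H → 2 * H < 3 * x → 2 * H < 3 * y → 2 * H < 3 * r → ⊥
no-three-thirds {H} {x} {y} {r} sizes hx hy hr = <-irrefl refl (begin-strict
  3 * (2 * H)                ≡⟨ solve 1 (λ h → con 3 :* (con 2 :* h) := con 2 :* h :+ con 2 :* h :+ con 2 :* h) refl H ⟩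
  2 * H + 2 * H + 2 * H      <⟨ +-mono-< (+-mono-< hx hy) hr ⟩
  3 * x + 3 * y + 3 * r      ≡⟨ solve 3 (λ x y r → con 3 :* x :+ con 3 :* y :+ con 3 :* r := con 3 :* (x :+ y :+ r)) refl x y r ⟩
  3 * (x + y + r)            ≡⟨ cong (3 *_) sizes ⟩
  3 * (2 * H)                ∎)
  where open ≤-Reasoning

-- Everything seen from coordinate i, orthogonal to the facet that contains T.
module Focus {m} (ET ES ES′ : CubeSym (suc m)) (t s s′ : ℕ) (sizes : t + s + s′ ≡ 2 ^ suc m)
  (bal : Balanced (seg ET t) (seg ES s) (seg ES′ s′)) (t<H : t < 2 ^ m) (s<H : s < 2 ^ m) (s′<H : s′ < 2 ^ m) where

  i : Fin (suc m)
  i = perm ET ⟨$⟩ˡ zero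

  private
    H = 2 ^ m
    T = seg ET t
    S = seg ES s
    S′ = seg ES′ s′

    ≤2H : ∀ {k} → k < H → k ≤ 2 ^ suc m
    ≤2H = ≤-double ∘ <⇒≤

    μ-T : μ (perm ET ⟨$⟩ʳ i) t ≡ 0
    μ-T = trans (cong (λ j → μ j t) (inverseʳ (perm ET))) (μ-zero-lower {m} t (<⇒≤ t<H))

    try : ∀ EA a EC c → a < H → c < H → t + a + c ≡ 2 * H → Balanced T (seg EA a) (seg EC c) →
          Partition T (seg EA a) (seg EC c) ⊎ Gap EA a i
    try EA a EC c a<H c<H sizes′ bal′ with facet-or-gap EA a i (<⇒≤ a<H)
    ... | inj₂ gap   = inj₂ gap
    ... | inj₁ facet = inj₁ (disjoint-pair-partition T (seg EA a) EC c
      (trans (cong₂ (λ p q → p + q + c) ∣T∣ ∣A∣) sizes′) bal′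
      (facet-pair-disjoint {A = T} {seg EA a} {seg EC c} {H = H} i ∣T∣ ∣A∣ (∣seg∣ EC c (≤2H c<H)) sizes′ c<H
        (*-cancelˡ-≡ _ _ 2 (bal′ i)) (facet-seg ET t i (≤2H t<H) μ-T) facet))
      where
      ∣T∣ : ∣ T ∣ ≡ t
      ∣T∣ = ∣seg∣ ET t (≤2H t<H)
      ∣A∣ : ∣ seg EA a ∣ ≡ a
      ∣A∣ = ∣seg∣ EA a (≤2H a<H)

  attempt : Partition T S S′ ⊎ Gap ES s i
  attempt = try ES s ES′ s′ s<H s′<H sizes bal

  attempt′ : Partition T S S′ ⊎ Gap ES′ s′ i
  attempt′ = map₁ (Partition-swap₂₃ {X = T} {S′} {S})
    (try ES′ s′ ES s s′<H s<H (trans (xy∙z≈xz∙y t s′ s) sizes) (Balanced-swap₂₃ {X = T} {S} {S′} bal))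

  bounds : Gap ES s i → Gap ES′ s′ i → H ≤ imbalance S s i + s × H ≤ imbalance S′ s′ i + s′
  bounds g g′ = bound-from-triangle {H} sizes t≤ (Gap.gap+s≤H g′)
              , bound-from-triangle {H} (trans (xy∙z≈xz∙y t s′ s) sizes)
                  (≤-trans t≤ (≤-reflexive (+-comm (imbalance S s i) _))) (Gap.gap+s≤H g)
    where
    open ≤-Reasoning
    double : ∀ a b c → 2 * a + 2 * b + 2 * c ≡ 2 * (a + b + c)
    double = solve 3 (λ a b c → con 2 :* a :+ con 2 :* b :+ con 2 :* c := con 2 :* (a :+ b :+ c)) refl
    t≤ : t ≤ imbalance S s i + imbalance S′ s′ i
    t≤ = begin
      t                                     ≡⟨ sym (trans (imbalance-seg ET t i (≤2H t<H)) (cong (λ k → t ∸ 2 * k) μ-T)) ⟩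
      imbalance T t i                       ≤⟨ imbalance-triangle {2 * M T i} {2 * M S i} {2 * M S′ i} {t} {s} {s′}
                                                 (trans (double (M T i) (M S i) (M S′ i)) (trans (bal i) (sym sizes))) ⟩
      imbalance S s i + imbalance S′ s′ i   ∎

_orElse_ : ∀ {A B : Set} → A ⊎ B → (B → A) → A
inj₁ a orElse _ = a
inj₂ b orElse k = k b
infixr 0 _orElse_

-- If no attempt finds a disjoint pair, the six gaps force 2^(m+1) < 3x, 3y, 3r.
module SmallSets {m} (EX EY EW : CubeSym (suc m)) (x y r : ℕ) (sizes : x + y + r ≡ 2 ^ suc m)
  (bal : Balanced (seg EX x) (seg EY y) (seg EW r)) (x<H : x < 2 ^ m) (y<H : y < 2 ^ m) (r<H : r < 2 ^ m) where

  private
    open Rotations {X = seg EX x} {seg EY y} {seg EW r} {x} {y} {r} sizes bal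
    module FX = Focus EX EY EW x y r sizes bal x<H y<H r<H
    module FY = Focus EY EW EX y r x sizes-Y bal-Y y<H r<H x<H
    module FW = Focus EW EX EY r x y sizes-W bal-W r<H x<H y<H

    six-gaps-impossible : Gap EY y FX.i → Gap EW r FX.i → Gap EW r FY.i → Gap EX x FY.i →
                          Gap EX x FW.i → Gap EY y FW.i → ⊥
    six-gaps-impossible gYX gWX gWY gXY gXW gYW = no-three-thirds {2 ^ m} {x} {y} {r} sizes
      (two-gaps gXY gXW (gap-off-top gWY) (proj₂ (FY.bounds gWY gXY)) (proj₁ (FW.bounds gXW gYW)))
      (two-gaps gYX gYW (gap-off-top gWX) (proj₁ (FX.bounds gYX gWX)) (proj₂ (FW.bounds gXW gYW)))
      (two-gaps gWX gWY (gap-off-top gYX) (proj₂ (FX.bounds gYX gWX)) (proj₁ (FY.bounds gWY gXY)))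

  partition : Partition (seg EX x) (seg EY y) (seg EW r)
  partition =
    FX.attempt                   orElse λ gYX →
    FX.attempt′                  orElse λ gWX →
    map₁ from-Y FY.attempt       orElse λ gWY →
    map₁ from-Y FY.attempt′      orElse λ gXY →
    map₁ from-W FW.attempt       orElse λ gXW →
    map₁ from-W FW.attempt′      orElse λ gYW →
    ⊥-elim (six-gaps-impossible gYX gWX gWY gXY gXW gYW)

single-vertex : ∀ x y r → x + y + r ≡ 1 → ind (0 <ᵇ x) + ind (0 <ᵇ y) + ind (0 <ᵇ r) ≡ 1
single-vertex 0 0 1 _ = refl
single-vertex 0 1 0 _ = refl
single-vertex 1 0 0 _ = refl
single-vertex 0 0 0 ()
single-vertex 0 0 (suc (suc r)) ()
single-vertex 0 1 (suc r) ()
single-vertex 0 (suc (suc y)) r ()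
single-vertex 1 0 (suc r) ()
single-vertex 1 (suc y) r ()
single-vertex (suc (suc x)) y r ()

core : ∀ n → Core n
core zero    EX EY EW x y r sizes bal [] = single-vertex x y r sizes
core (suc m) EX EY EW x y r sizes bal = by-size (2 ^ m ≤? x) (2 ^ m ≤? y) (2 ^ m ≤? r)
  where
  open Rotations {X = seg EX x} {seg EY y} {seg EW r} {x} {y} {r} sizes bal
  by-size : Dec (2 ^ m ≤ x) → Dec (2 ^ m ≤ y) → Dec (2 ^ m ≤ r) → Partition (seg EX x) (seg EY y) (seg EW r)
  by-size (yes H≤x) _         _         = big-set-partition (core m) EX EY EW x y r sizes bal H≤x
  by-size (no _)    (yes H≤y) _         = from-Y (big-set-partition (core m) EY EW EX y r x sizes-Y bal-Y H≤y)
  by-size (no _)    (no _)    (yes H≤r) = from-W (big-set-partition (core m) EW EX EY r x y sizes-W bal-W H≤r)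
  by-size (no x≱H)  (no y≱H)  (no r≱H)  =
    SmallSets.partition EX EY EW x y r sizes bal (≰⇒> x≱H) (≰⇒> y≱H) (≰⇒> r≱H)

M-additive⇒∪≐I : ∀ {n} (E₁ E₂ : CubeSym n) a b → a + b ≤ 2 ^ n →
  (∀ i → M (seg E₁ a) i + M (seg E₂ b) i ≡ μ i (a + b)) → (seg E₁ a ∪ seg E₂ b) ≐ I (a + b)
M-additive⇒∪≐I {n} E₁ E₂ a b a+b≤2^n M≡ v = complement-partition (seg E₁ a v) (seg E₂ b v) (I (a + b) v)
  (trans (cong (λ t → ind (seg E₁ a v) + ind (seg E₂ b v) + ind t) (sym (W≐ v)))
         (core n E₁ E₂ (complement identity) a b r sizes bal v))
  where
  r = 2 ^ n ∸ (a + b)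
  sizes : a + b + r ≡ 2 ^ n
  sizes = m+[n∸m]≡n a+b≤2^n
  W≐ : seg (complement identity) r ≐ ∁ (I (a + b))
  W≐ = seg-complement-identity (a + b) r sizes
  bal : Balanced (seg E₁ a) (seg E₂ b) (seg (complement identity) r)
  bal i = begin
    2 * (M (seg E₁ a) i + M (seg E₂ b) i + M (seg (complement identity) r) i)
      ≡⟨ cong₂ (λ p q → 2 * (p + q)) (M≡ i) (M-cong W≐ i) ⟩
    2 * (μ i (a + b) + M (∁ (I (a + b))) i)
      ≡⟨ cong (2 *_) (trans (+-comm (μ i (a + b)) _) (M-∁ (I (a + b)) i)) ⟩
    2 * M full i
      ≡⟨ 2*M-full i ⟩
    2 ^ n ∎
    where open ≡-Reasoning
  complement-partition : ∀ a b c → ind a + ind b + ind (not c) ≡ 1 → (a ∨ b) ≡ c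
  complement-partition false false false _ = refl
  complement-partition false true  true  _ = refl
  complement-partition true  false true  _ = refl
  complement-partition false false true  ()
  complement-partition false true  false ()
  complement-partition true  false false ()
  complement-partition true  true  _     ()

∪≐⇒M-additive : ∀ {n} {A B U : Subset n} → (A ∪ B) ≐ U → ∣ A ∣ + ∣ B ∣ ≡ ∣ U ∣ →
                ∀ i → M A i + M B i ≡ M U i
∪≐⇒M-additive {A = A} {B} A∪B≐U sizes i =
  trans (sym (M-∪ (∣∪∣≡+⇒Disjoint {S = A} {B} (trans (∣∣-cong A∪B≐U) (sym sizes))) i)) (M-cong A∪B≐U i)

mainTheorem1 : (n : ℕ) → 1 ≤ n → (a b : ℕ) → 0 < a → 0 < b → a + b ≤ 2 ^ n →
    (g₁ g₂ : Aut n) →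
    MSumEq (image g₁ (I a)) (image g₂ (I b)) (I (a + b))
      ⇔ ((image g₁ (I a) ∪ image g₂ (I b)) ≐ I (a + b))
mainTheorem1 n _ a b _ _ a+b≤2^n g₁ g₂ = mk⇔ forward backward
  where
  A = image g₁ (I a)
  B = image g₂ (I b)
  E₁ = proj₁ (automorphism-image g₁)
  E₂ = proj₁ (automorphism-image g₂)
  A≐ : A ≐ seg E₁ a
  A≐ = proj₂ (automorphism-image g₁) (I a)
  B≐ : B ≐ seg E₂ b
  B≐ = proj₂ (automorphism-image g₂) (I b)

  forward : MSumEq A B (I (a + b)) → (A ∪ B) ≐ I (a + b)
  forward m-sum v = trans (cong₂ _∨_ (A≐ v) (B≐ v)) (M-additive⇒∪≐I E₁ E₂ a b a+b≤2^n M-sum v)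
    where
    M-sum : ∀ i → M (seg E₁ a) i + M (seg E₂ b) i ≡ μ i (a + b)
    M-sum i = trans (sym (cong₂ _+_ (trans (m≡M A i) (M-cong A≐ i)) (trans (m≡M B i) (M-cong B≐ i))))
                    (trans (m-sum i) (m≡M (I (a + b)) i))

  backward : (A ∪ B) ≐ I (a + b) → MSumEq A B (I (a + b))
  backward A∪B≐I i = trans (cong₂ _+_ (m≡M A i) (m≡M B i))
                           (trans (∪≐⇒M-additive A∪B≐I sizes i) (sym (m≡M (I (a + b)) i)))
    where
    sizes : ∣ A ∣ + ∣ B ∣ ≡ ∣ I {n} (a + b) ∣
    sizes = trans (cong₂ _+_ (∣image-I∣ g₁ a (≤-trans (m≤m+n a b) a+b≤2^n))
                             (∣image-I∣ g₂ b (≤-trans (m≤n+m b a) a+b≤2^n)))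
                  (sym (∣I∣ n (a + b) a+b≤2^n))
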